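{- For a matroid $\mathcal{M}$ the following are equivalent: (a) $\mathcal{M}$ is Rayleigh; (b) every matroid of the form $\mathcal{M}[\mathbf{m}]$ is Rayleigh; (c) every matroid of the form $\mathcal{M}[\mathbf{m}]$ is balanced; (d) every matroid of the form $\mathcal{M}[\mathbf{m}]$ is negatively correlated. Here $\mathbf{m}$ ranges over all families $\{m_e:e\in E(\mathcal{M})\}$ of positive integers.
   Context: For a matroid $\mathcal{M}$ on a finite set $E$ with indeterminates $\mathbf{y}=\{y_c:c\in E\}$ and disjoint $I,J\subseteq E$, $M_I^J(\mathbf{y}):=\sum_B\prod_{c\in B\setminus I}y_c$, summed over bases $B$ with $I\subseteq B$, $B\cap J=\varnothing$. For distinct $e,f$: $\Delta M\{e,f\}:=M_e^fM_f^e-M_{ef}M^{ef}$. $\mathcal{M}$ is Rayleigh if $\Delta M\{e,f\}(\mathbf{y})\ge0$ for all distinct $e,f$ whenever all $y_c>0$; negatively correlated if $\Delta M\{e,f\}(\mathbf{1})\ge0$ for all distinct $e,f$ (all $y_c=1$); balanced if every minor is negatively correlated. For positive integers $\mathbf{m}=\{m_e:e\in E\}$, $\mathcal{M}[\mathbf{m}]$ is the matroid obtained from $\mathcal{M}$ by replacing each element $e$ by a parallel class of $m_e$ elements.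
   Formalization: The values $y_c$ in the Rayleigh condition, for $\mathcal{M}$ and for every $\mathcal{M}[\mathbf{m}]$, range over the positive rationals rather than the positive reals. -}

module Defs where

open import Data.Bool using (Bool; true; false; _∧_; not; if_then_else_)
open import Data.Nat as ℕ using (ℕ; zero; suc; _≤_)
open import Data.Fin using (Fin; zero; suc; splitAt; _≟_)
open import Data.Fin.Subset using (Subset; ⁅_⁆; _∪_; _-_; ∣_∣)
open import Data.Vec as Vec using (Vec; []; _∷_; lookup; tabulate; insertAt; updateAt)
open import Data.List as List using (List; []; _∷_; _++_; allFin)
open import Data.Sum using (inj₁; inj₂)
open import Data.Bool.ListAction renaming (all to allᵇ; any to anyᵇ)
open import Data.Product using (Σ; ∃; _×_; _,_)
open import Function.Bundles using (_⇔_)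
open import Relation.Nullary.Decidable using (⌊_⌋)
open import Relation.Binary.PropositionalEquality using (_≡_; _≢_)
open import Data.Rational as ℚ using (ℚ; 0ℚ; 1ℚ)

allSubsets : (n : ℕ) → List (Subset n)
allSubsets zero    = [] ∷ []
allSubsets (suc n) = List.map (true ∷_) (allSubsets n) ++ List.map (false ∷_) (allSubsets n)

_∈ᵇ_ : ∀ {n} → Fin n → Subset n → Bool
i ∈ᵇ S = lookup S i

_+ₛ_ : ∀ {n} → Subset n → Fin n → Subset n
S +ₛ y = updateAt S y (λ _ → true)

-- A (raw) basis system on the ground set E = Fin n: a decidable
-- predicate saying which subsets are bases.  A matroid is a basis
-- system satisfying the basis axioms (IsMatroid).

BasisSystem : ℕ → Set
BasisSystem n = Subset n → Bool

IsBasis : ∀ {n} → BasisSystem n → Subset n → Set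
IsBasis M B = M B ≡ true

record IsMatroid {n : ℕ} (M : BasisSystem n) : Set where
  field
    basis-nonempty : ∃ λ B → IsBasis M B
    basis-exchange : ∀ B₁ B₂ → IsBasis M B₁ → IsBasis M B₂ →
                     ∀ x → x ∈ᵇ B₁ ≡ true → x ∈ᵇ B₂ ≡ false →
                     Σ (Fin n) λ y → (y ∈ᵇ B₂ ≡ true) × (y ∈ᵇ B₁ ≡ false) ×
                       IsBasis M ((B₁ - x) +ₛ y)

-- Basis generating polynomials, evaluated at y : E → ℚ.
-- M_I^J(y) = Σ_{B basis, I ⊆ B, B ∩ J = ∅} Π_{c ∈ B \ I} y_c

prodOver : ∀ {n} → (Fin n → Bool) → (Fin n → ℚ) → ℚ
prodOver {n} P y = List.foldr (λ c acc → (if P c then y c else 1ℚ) ℚ.* acc) 1ℚ (allFin n)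

sumℚ : List ℚ → ℚ
sumℚ = List.foldr ℚ._+_ 0ℚ

admissible : ∀ {n} → Subset n → Subset n → Subset n → Bool
admissible {n} I J B =
  allᵇ (λ c → (if c ∈ᵇ I then c ∈ᵇ B else true) ∧ (if c ∈ᵇ J then not (c ∈ᵇ B) else true)) (allFin n)

genPoly : ∀ {n} → BasisSystem n → (I J : Subset n) → (Fin n → ℚ) → ℚ
genPoly {n} M I J y =
  sumℚ (List.map (λ B → if M B ∧ admissible I J B
                          then prodOver (λ c → c ∈ᵇ B ∧ not (c ∈ᵇ I)) y
                          else 0ℚ)
                 (allSubsets n))

∅ₛ : ∀ {n} → Subset n
∅ₛ = Vec.replicate _ false

Δ : ∀ {n} → BasisSystem n → Fin n → Fin n → (Fin n → ℚ) → ℚ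
Δ M e f y =
  genPoly M ⁅ e ⁆ ⁅ f ⁆ y ℚ.* genPoly M ⁅ f ⁆ ⁅ e ⁆ y
  ℚ.- genPoly M (⁅ e ⁆ ∪ ⁅ f ⁆) ∅ₛ y ℚ.* genPoly M ∅ₛ (⁅ e ⁆ ∪ ⁅ f ⁆) y

Rayleigh : ∀ {n} → BasisSystem n → Set
Rayleigh {n} M = (y : Fin n → ℚ) → (∀ c → 0ℚ ℚ.< y c) →
                 (e f : Fin n) → e ≢ f → 0ℚ ℚ.≤ Δ M e f y

NegCorrelated : ∀ {n} → BasisSystem n → Set
NegCorrelated {n} M = (e f : Fin n) → e ≢ f → 0ℚ ℚ.≤ Δ M e f (λ _ → 1ℚ)

-- Minors: single-element deletion and contraction.
-- The ground set E ∖ {e} is identified with Fin n via insertAt.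

isLoop : ∀ {n} → BasisSystem n → Fin n → Bool
isLoop {n} M e = allᵇ (λ B → not (M B ∧ (e ∈ᵇ B))) (allSubsets n)

isColoop : ∀ {n} → BasisSystem n → Fin n → Bool
isColoop {n} M e = allᵇ (λ B → not (M B ∧ not (e ∈ᵇ B))) (allSubsets n)

-- M \ e : bases are bases of M avoiding e (or B - e for all B if e is a coloop)
delete : ∀ {n} → BasisSystem (suc n) → Fin (suc n) → BasisSystem n
delete M e S = if isColoop M e then M (insertAt S e true) else M (insertAt S e false)

-- M / e : bases are B - e for bases B containing e (or all B if e is a loop)
contract : ∀ {n} → BasisSystem (suc n) → Fin (suc n) → BasisSystem n
contract M e S = if isLoop M e then M (insertAt S e false) else M (insertAt S e true)

data Minor : ∀ {k n} → BasisSystem k → BasisSystem n → Set where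
  self : ∀ {n} {M : BasisSystem n} → Minor M M
  del  : ∀ {k n} {N : BasisSystem k} {M : BasisSystem (suc n)} (e : Fin (suc n)) →
         Minor N (delete M e) → Minor N M
  con  : ∀ {k n} {N : BasisSystem k} {M : BasisSystem (suc n)} (e : Fin (suc n)) →
         Minor N (contract M e) → Minor N M

Balanced : ∀ {n} → BasisSystem n → Set
Balanced {n} M = ∀ k (N : BasisSystem k) → Minor N M → NegCorrelated N

-- Parallel extension M[m]: element e is replaced by m_e parallel copies.
-- Ground set Fin (sum m); the copies of e form a contiguous block.

parent : ∀ {n} (m : Vec ℕ n) → Fin (Vec.sum m) → Fin n
parent (m₀ ∷ ms) k with splitAt m₀ k
... | inj₁ _  = zero
... | inj₂ k′ = suc (parent ms k′)

image : ∀ {n} (m : Vec ℕ n) → Subset (Vec.sum m) → Subset n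
image {n} m S = tabulate λ e → anyᵇ (λ k → k ∈ᵇ S ∧ ⌊ parent m k ≟ e ⌋) (allFin (Vec.sum m))

fibre : ∀ {n} (m : Vec ℕ n) → Subset (Vec.sum m) → Fin n → Subset (Vec.sum m)
fibre m S e = tabulate λ k → k ∈ᵇ S ∧ ⌊ parent m k ≟ e ⌋

parallelExt : ∀ {n} → BasisSystem n → (m : Vec ℕ n) → BasisSystem (Vec.sum m)
parallelExt {n} M m S =
  M (image m S) ∧ allᵇ (λ e → ⌊ ∣ fibre m S e ∣ ℕ.≤? 1 ⌋) (allFin n)

Positive : ∀ {n} → Vec ℕ n → Set
Positive m = ∀ i → 1 ≤ lookup m i

-- A basis of M[m] contains at most one copy of each element, so the basis generating polynomial of M[m]
-- is that of M with y_e replaced by the sum of the variables of the copies of e. Hence for copies e′, f′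
-- of distinct e, f, ΔM[m]{e′,f′} is ΔM{e,f} evaluated at these sums, while for two copies of the same
-- element M[m]_{e′f′} = 0 and ΔM[m]{e′,f′} = M[m]_{e′}^{f′} M[m]_{f′}^{e′} ≥ 0; so (a) ⇒ (b).
-- Rayleigh passes to minors: giving e the variable t, ΔM{f,g} is a quadratic in t that is nonnegative
-- for t > 0, and its constant and leading coefficients are the Rayleigh differences of M ∖ e and M / e.
-- Since Rayleigh implies negatively correlated (y = 1), (b) ⇒ (c) ⇒ (d). Finally, negative correlation
-- of M[m] says ΔM ≥ 0 at the positive integer point m; as all bases have the same size, ΔM is
-- homogeneous, and clearing denominators gives ΔM(y) ≥ 0 at every positive rational y, i.e. (d) ⇒ (a).

module Submission where

open import Defs
open import Data.Bool using (Bool; true; false; _∧_; _∨_; not; if_then_else_)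
open import Data.Nat as ℕ using (ℕ; zero; suc)
import Data.Nat.Properties as ℕP
open import Data.Nat.Coprimality using (Coprime)
open import Data.Fin using (Fin; zero; suc; _≟_; fromℕ<; punchIn; punchOut; _↑ˡ_; _↑ʳ_; splitAt)
open import Data.Fin.Properties
  using (suc-injective; punchInᵢ≢i; punchIn-injective; punchIn-punchOut; splitAt-↑ˡ; splitAt-↑ʳ; splitAt⁻¹-↑ˡ; splitAt⁻¹-↑ʳ; ↑ˡ-injective; ↑ʳ-injective)
open import Data.Fin.Subset using (Subset; ⁅_⁆; _∪_; _∩_; ∁; _─_; ∣_∣)
open import Data.Fin.Subset.Properties using (x∈⁅x⁆; x≢y⇒x∉⁅y⁆)
open import Data.Vec as Vec using (Vec; []; _∷_; lookup; insertAt; tabulate)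
import Data.Vec.Functional as VecF
import Data.Vec.Functional.Properties as VecFₚ
open import Data.List as List using ([]; _∷_; _++_)
import Data.List.Properties as Listₚ
import Data.Vec.Properties as Vecₚ
open import Data.Bool.ListAction renaming (all to allᵇ; any to anyᵇ)
open import Data.Bool.Properties using (∨-assoc; ∨-identityʳ; ∧-identityʳ; ∧-zeroʳ; ∧-commutativeMonoid)
open import Algebra.Bundles using (CommutativeMonoid)
open import Algebra.Properties.CommutativeSemigroup (CommutativeMonoid.commutativeSemigroup ∧-commutativeMonoid)
  using () renaming (x∙yz≈y∙xz to ∧-swap)
open import Data.Rational as ℚ using (ℚ; mkℚ; 0ℚ; 1ℚ; _+_; _*_; _-_; _≤_; _<_; toℚᵘ)
import Data.Rational.Properties as ℚP
import Data.Rational.Unnormalised as ℚᵘ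
import Data.Rational.Unnormalised.Properties as ℚᵘP
import Data.Integer as ℤ
import Data.Integer.Properties as ℤP
import Data.Integer.Solver
module Z = Data.Integer.Solver.+-*-Solver
open import Data.Rational.Solver using (module +-*-Solver)
open +-*-Solver
open import Data.Empty using (⊥-elim)
open import Data.Product using (Σ; _×_; _,_; proj₁; proj₂)
open import Data.Sum using (inj₁; inj₂)
open import Function using (_∘_)
open import Function.Bundles using (_⇔_; mk⇔)
open import Relation.Nullary using (yes; no)
open import Relation.Nullary.Decidable using (⌊_⌋)
open import Relation.Binary.PropositionalEquality

private variable n : ℕ

-- Weighted sums over the subsets of Fin n

-- A weight assigns to each element c the factor φ c true if c belongs to the set and φ c false otherwise.
Weight : ℕ → Set
Weight n = Fin n → Bool → ℚ

_≐_ : Weight n → Weight n → Set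
φ ≐ ψ = ∀ c b → φ c b ≡ ψ c b

weightedSum : (Subset n → ℚ) → Weight n → ℚ
weightedSum {zero}  G φ = G []
weightedSum {suc n} G φ = φ zero true  * weightedSum (λ S → G (true ∷ S)) (φ ∘ suc)
                        + φ zero false * weightedSum (λ S → G (false ∷ S)) (φ ∘ suc)

weightedSum-cong : ∀ {G G′ : Subset n → ℚ} {φ ψ : Weight n} →
                   (∀ S → G S ≡ G′ S) → φ ≐ ψ → weightedSum G φ ≡ weightedSum G′ ψ
weightedSum-cong {zero}  G≗G′ φ≐ψ = G≗G′ []
weightedSum-cong {suc n} G≗G′ φ≐ψ =
  cong₂ _+_ (cong₂ _*_ (φ≐ψ zero true)  (weightedSum-cong (G≗G′ ∘ (true ∷_))  (φ≐ψ ∘ suc)))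
            (cong₂ _*_ (φ≐ψ zero false) (weightedSum-cong (G≗G′ ∘ (false ∷_)) (φ≐ψ ∘ suc)))

weightedSum-*ˡ : ∀ k (G : Subset n → ℚ) φ → weightedSum (λ S → k * G S) φ ≡ k * weightedSum G φ
weightedSum-*ˡ {zero}  k G φ = refl
weightedSum-*ˡ {suc n} k G φ
  rewrite weightedSum-*ˡ k (λ S → G (true ∷ S)) (φ ∘ suc)
        | weightedSum-*ˡ k (λ S → G (false ∷ S)) (φ ∘ suc) =
  solve 5 (λ a b x y k → a :* (k :* x) :+ b :* (k :* y) := k :* (a :* x :+ b :* y)) refl
    (φ zero true) (φ zero false) _ _ k

weightedSum-zero : ∀ {G : Subset n → ℚ} (φ : Weight n) → (∀ S → G S ≡ 0ℚ) → weightedSum G φ ≡ 0ℚ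
weightedSum-zero {zero}  φ G≡0 = G≡0 []
weightedSum-zero {suc n} φ G≡0
  rewrite weightedSum-zero (φ ∘ suc) (G≡0 ∘ (true ∷_))
        | weightedSum-zero (φ ∘ suc) (G≡0 ∘ (false ∷_)) =
  solve 2 (λ a b → a :* con 0ℚ :+ b :* con 0ℚ := con 0ℚ) refl (φ zero true) (φ zero false)

weightedSum-expand : ∀ (k : Fin (suc n)) (G : Subset (suc n) → ℚ) φ →
  weightedSum G φ ≡ φ k true  * weightedSum (λ S → G (insertAt S k true))  (φ ∘ punchIn k)
                  + φ k false * weightedSum (λ S → G (insertAt S k false)) (φ ∘ punchIn k)
weightedSum-expand zero G φ = refl
weightedSum-expand {suc n} (suc k) G φ
  rewrite weightedSum-expand k (λ S → G (true ∷ S)) (φ ∘ suc)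
        | weightedSum-expand k (λ S → G (false ∷ S)) (φ ∘ suc) =
  solve 8 (λ a b c d x₁ x₂ x₃ x₄ →
             a :* (c :* x₁ :+ d :* x₂) :+ b :* (c :* x₃ :+ d :* x₄)
          := c :* (a :* x₁ :+ b :* x₃) :+ d :* (a :* x₂ :+ b :* x₄)) refl
    (φ zero true) (φ zero false) (φ (suc k) true) (φ (suc k) false) _ _ _ _

𝟙 : Bool → ℚ
𝟙 b = if b then 1ℚ else 0ℚ

basisSum : BasisSystem n → Weight n → ℚ
basisSum M = weightedSum (𝟙 ∘ M)

unitWeight : Weight n
unitWeight _ _ = 1ℚ

∏ : (Fin n → ℚ) → ℚ
∏ {zero}  g = 1ℚ
∏ {suc n} g = g zero * ∏ (g ∘ suc)

sumℚ-++ : ∀ xs ys → sumℚ (xs ++ ys) ≡ sumℚ xs + sumℚ ys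
sumℚ-++ []       ys = sym (ℚP.+-identityˡ _)
sumℚ-++ (x ∷ xs) ys = trans (cong (x +_) (sumℚ-++ xs ys)) (sym (ℚP.+-assoc x _ _))

sum-allSubsets : ∀ (F : Subset n → ℚ) → sumℚ (List.map F (allSubsets n)) ≡ weightedSum F unitWeight
sum-allSubsets {zero}  F = ℚP.+-identityʳ _
sum-allSubsets {suc n} F = begin
  sumℚ (List.map F (List.map (true ∷_) (allSubsets n) ++ List.map (false ∷_) (allSubsets n)))
    ≡⟨ cong sumℚ (Listₚ.map-++ F (List.map (true ∷_) (allSubsets n)) _) ⟩
  sumℚ (List.map F (List.map (true ∷_) (allSubsets n)) ++ List.map F (List.map (false ∷_) (allSubsets n)))
    ≡⟨ sumℚ-++ (List.map F (List.map (true ∷_) (allSubsets n))) _ ⟩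
  sumℚ (List.map F (List.map (true ∷_) (allSubsets n))) + sumℚ (List.map F (List.map (false ∷_) (allSubsets n)))
    ≡⟨ cong₂ _+_ (half true) (half false) ⟩
  weightedSum F unitWeight ∎
  where
  open ≡-Reasoning
  half : ∀ b → sumℚ (List.map F (List.map (b ∷_) (allSubsets n))) ≡ 1ℚ * weightedSum (λ S → F (b ∷ S)) unitWeight
  half b = begin
    sumℚ (List.map F (List.map (b ∷_) (allSubsets n))) ≡⟨ cong sumℚ (sym (Listₚ.map-∘ (allSubsets n))) ⟩
    sumℚ (List.map (λ S → F (b ∷ S)) (allSubsets n))   ≡⟨ sum-allSubsets (λ S → F (b ∷ S)) ⟩
    weightedSum (λ S → F (b ∷ S)) unitWeight           ≡⟨ sym (ℚP.*-identityˡ _) ⟩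
    1ℚ * weightedSum (λ S → F (b ∷ S)) unitWeight      ∎

weightedSum-∏ : ∀ (G : Subset n → ℚ) φ →
  weightedSum (λ S → G S * ∏ (λ c → φ c (lookup S c))) unitWeight ≡ weightedSum G φ
weightedSum-∏ {zero}  G φ = ℚP.*-identityʳ _
weightedSum-∏ {suc n} G φ = cong₂ _+_ (half true) (half false)
  where
  half : ∀ b → 1ℚ * weightedSum (λ S → G (b ∷ S) * (φ zero b * ∏ (λ c → φ (suc c) (lookup S c)))) unitWeight
             ≡ φ zero b * weightedSum (λ S → G (b ∷ S)) (φ ∘ suc)
  half b = begin
    1ℚ * weightedSum (λ S → G (b ∷ S) * (φ zero b * ∏ (λ c → φ (suc c) (lookup S c)))) unitWeight
      ≡⟨ ℚP.*-identityˡ _ ⟩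
    weightedSum (λ S → G (b ∷ S) * (φ zero b * ∏ (λ c → φ (suc c) (lookup S c)))) unitWeight
      ≡⟨ weightedSum-cong (λ S → solve 3 (λ g a p → g :* (a :* p) := a :* (g :* p)) refl
                                        (G (b ∷ S)) (φ zero b) (∏ (λ c → φ (suc c) (lookup S c))))
                           (λ _ _ → refl) ⟩
    weightedSum (λ S → φ zero b * (G (b ∷ S) * ∏ (λ c → φ (suc c) (lookup S c)))) unitWeight
      ≡⟨ weightedSum-*ˡ (φ zero b) (λ S → G (b ∷ S) * ∏ (λ c → φ (suc c) (lookup S c))) unitWeight ⟩
    φ zero b * weightedSum (λ S → G (b ∷ S) * ∏ (λ c → φ (suc c) (lookup S c))) unitWeight
      ≡⟨ cong (φ zero b *_) (weightedSum-∏ (λ S → G (b ∷ S)) (φ ∘ suc)) ⟩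
    φ zero b * weightedSum (λ S → G (b ∷ S)) (φ ∘ suc) ∎
    where open ≡-Reasoning

foldr-*-tabulate : ∀ {m} (h : Fin n → ℚ) (g : Fin m → Fin n) →
                   List.foldr (λ c acc → h c * acc) 1ℚ (List.tabulate g) ≡ ∏ (h ∘ g)
foldr-*-tabulate {m = zero}  h g = refl
foldr-*-tabulate {m = suc m} h g = cong (h (g zero) *_) (foldr-*-tabulate h (g ∘ suc))

if-all-foldr-* : ∀ {A : Set} (a : A → Bool) (g : A → ℚ) xs →
  (if allᵇ a xs then List.foldr (λ c acc → g c * acc) 1ℚ xs else 0ℚ)
  ≡ List.foldr (λ c acc → (if a c then g c else 0ℚ) * acc) 1ℚ xs
if-all-foldr-* a g []       = refl
if-all-foldr-* a g (x ∷ xs) with a x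
... | false = sym (ℚP.*-zeroˡ (List.foldr (λ c acc → (if a c then g c else 0ℚ) * acc) 1ℚ xs))
... | true  = trans (if-*ˡ (allᵇ a xs)) (cong (g x *_) (if-all-foldr-* a g xs))
  where
  if-*ˡ : ∀ b → (if b then g x * List.foldr (λ c acc → g c * acc) 1ℚ xs else 0ℚ)
              ≡ g x * (if b then List.foldr (λ c acc → g c * acc) 1ℚ xs else 0ℚ)
  if-*ˡ true  = refl
  if-*ˡ false = sym (ℚP.*-zeroʳ (g x))

-- The weight under which basisSum M is M_I^J(y): elements of I are forced into the basis, those of J out of it.
polyWeight : Subset n → Subset n → (Fin n → ℚ) → Weight n
polyWeight I J y c b =
  if (if c ∈ᵇ I then b else true) ∧ (if c ∈ᵇ J then not b else true)
  then (if b ∧ not (c ∈ᵇ I) then y c else 1ℚ) else 0ℚ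

genPoly≡basisSum : ∀ (M : BasisSystem n) I J y → genPoly M I J y ≡ basisSum M (polyWeight I J y)
genPoly≡basisSum {n} M I J y =
  trans (sum-allSubsets {n} _)
        (trans (weightedSum-cong {n} term (λ _ _ → refl)) (weightedSum-∏ (𝟙 ∘ M) (polyWeight I J y)))
  where
  term : ∀ B → (if M B ∧ admissible I J B then prodOver (λ c → c ∈ᵇ B ∧ not (c ∈ᵇ I)) y else 0ℚ)
             ≡ 𝟙 (M B) * ∏ (λ c → polyWeight I J y c (lookup B c))
  term B with M B
  ... | false = sym (ℚP.*-zeroˡ (∏ (λ c → polyWeight I J y c (lookup B c))))
  ... | true  = trans (if-all-foldr-* _ (λ c → if c ∈ᵇ B ∧ not (c ∈ᵇ I) then y c else 1ℚ) (List.allFin n))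
                      (trans (foldr-*-tabulate (λ c → polyWeight I J y c (lookup B c)) (λ c → c))
                             (sym (ℚP.*-identityˡ (∏ (λ c → polyWeight I J y c (lookup B c))))))

forceIn forceOut : Bool → ℚ
forceIn  = 𝟙
forceOut = 𝟙 ∘ not

weightOf : (Fin n → ℚ) → Weight n
weightOf y c b = if b then y c else 1ℚ

pin : Fin n → (Bool → ℚ) → Weight n → Weight n
pin k χ φ c with c ≟ k
... | yes _ = χ
... | no  _ = φ c

pin-here : ∀ k χ (φ : Weight n) {c} → c ≡ k → ∀ b → pin k χ φ c b ≡ χ b
pin-here k χ φ {c} c≡k b with c ≟ k
... | yes _  = refl
... | no c≢k = ⊥-elim (c≢k c≡k)

pin-there : ∀ k χ (φ : Weight n) {c} → c ≢ k → ∀ b → pin k χ φ c b ≡ φ c b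
pin-there k χ φ {c} c≢k b with c ≟ k
... | yes c≡k = ⊥-elim (c≢k c≡k)
... | no _    = refl

≐-pin : ∀ {ψ : Weight n} k χ φ → (∀ b → ψ k b ≡ χ b) → (∀ c → c ≢ k → ∀ b → ψ c b ≡ φ c b) →
        ψ ≐ pin k χ φ
≐-pin k χ φ at-k off-k c b with c ≟ k
... | yes refl = at-k b
... | no c≢k   = off-k c c≢k b

≐-pin₂ : ∀ {ψ : Weight n} {e f} χ₁ χ₂ φ →
         (∀ b → ψ e b ≡ χ₁ b) → (∀ b → ψ f b ≡ χ₂ b) →
         (∀ c → c ≢ e → c ≢ f → ∀ b → ψ c b ≡ φ c b) → ψ ≐ pin e χ₁ (pin f χ₂ φ)
≐-pin₂ {e = e} {f} χ₁ χ₂ φ at-e at-f elsewhere c b with c ≟ e | c ≟ f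
... | yes refl | _        = at-e b
... | no _     | yes refl = trans (at-f b) (sym (pin-here f χ₂ φ refl b))
... | no c≢e   | no c≢f   = trans (elsewhere c c≢e c≢f b) (sym (pin-there f χ₂ φ c≢f b))

pin-cong : ∀ k {χ χ′ : Bool → ℚ} {φ φ′ : Weight n} → (∀ b → χ b ≡ χ′ b) → φ ≐ φ′ → pin k χ φ ≐ pin k χ′ φ′
pin-cong k {χ} {φ = φ} χ≗χ′ φ≐φ′ =
  ≐-pin k _ _ (λ b → trans (pin-here k χ φ refl b) (χ≗χ′ b))
              (λ c c≢k b → trans (pin-there k χ φ c≢k b) (φ≐φ′ c b))

pin-pin : ∀ k χ χ′ (φ : Weight n) → pin k χ (pin k χ′ φ) ≐ pin k χ φ
pin-pin k χ χ′ φ = ≐-pin k χ φ (pin-here k χ _ refl)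
  (λ c c≢k b → trans (pin-there k χ _ c≢k b) (pin-there k χ′ φ c≢k b))

pin-comm : ∀ {e f} χ₁ χ₂ (φ : Weight n) → e ≢ f → pin f χ₂ (pin e χ₁ φ) ≐ pin e χ₁ (pin f χ₂ φ)
pin-comm {e = e} {f} χ₁ χ₂ φ e≢f = ≐-pin₂ χ₁ χ₂ φ
  (λ b → trans (pin-there f χ₂ _ e≢f b) (pin-here e χ₁ φ refl b))
  (pin-here f χ₂ _ refl)
  (λ c c≢e c≢f b → trans (pin-there f χ₂ _ c≢f b) (pin-there e χ₁ φ c≢e b))

weightedSum-pin : ∀ (G : Subset (suc n) → ℚ) φ k →
  weightedSum G φ ≡ φ k true * weightedSum G (pin k forceIn φ) + φ k false * weightedSum G (pin k forceOut φ)
weightedSum-pin G φ k = begin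
  weightedSum G φ                     ≡⟨ weightedSum-expand k G φ ⟩
  φ k true * X true + φ k false * X false
    ≡⟨ cong₂ (λ u v → φ k true * u + φ k false * v)
             (solve 2 (λ x x′ → x := con 1ℚ :* x :+ con 0ℚ :* x′) refl (X true) (X false))
             (solve 2 (λ x x′ → x′ := con 0ℚ :* x :+ con 1ℚ :* x′) refl (X true) (X false)) ⟩
  φ k true * (1ℚ * X true + 0ℚ * X false) + φ k false * (0ℚ * X true + 1ℚ * X false)
    ≡⟨ cong₂ (λ u v → φ k true * u + φ k false * v) (sym (expand-pin forceIn)) (sym (expand-pin forceOut)) ⟩
  φ k true * weightedSum G (pin k forceIn φ) + φ k false * weightedSum G (pin k forceOut φ) ∎
  where
  open ≡-Reasoning
  X : Bool → ℚ
  X b = weightedSum (λ S → G (insertAt S k b)) (φ ∘ punchIn k)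
  expand-pin : ∀ χ → weightedSum G (pin k χ φ) ≡ χ true * X true + χ false * X false
  expand-pin χ = begin
    weightedSum G (pin k χ φ)
      ≡⟨ weightedSum-expand k G (pin k χ φ) ⟩
    pin k χ φ k true * weightedSum (λ S → G (insertAt S k true)) (pin k χ φ ∘ punchIn k)
      + pin k χ φ k false * weightedSum (λ S → G (insertAt S k false)) (pin k χ φ ∘ punchIn k)
      ≡⟨ cong₂ _+_ (cong₂ _*_ (pin-here k χ φ refl true) (away true))
                   (cong₂ _*_ (pin-here k χ φ refl false) (away false)) ⟩
    χ true * X true + χ false * X false ∎
    where
    away : ∀ b → weightedSum (λ S → G (insertAt S k b)) (pin k χ φ ∘ punchIn k) ≡ X b
    away b = weightedSum-cong (λ _ → refl) (λ c → pin-there k χ φ (punchInᵢ≢i k c))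

pinnedSum : BasisSystem n → Fin n → Fin n → (Bool → ℚ) → (Bool → ℚ) → Weight n → ℚ
pinnedSum M e f χ₁ χ₂ φ = basisSum M (pin e χ₁ (pin f χ₂ φ))

pinnedSum-cong : ∀ (M : BasisSystem n) e f {χ₁ χ₁′ χ₂ χ₂′ φ φ′} →
  (∀ b → χ₁ b ≡ χ₁′ b) → (∀ b → χ₂ b ≡ χ₂′ b) → φ ≐ φ′ → pinnedSum M e f χ₁ χ₂ φ ≡ pinnedSum M e f χ₁′ χ₂′ φ′
pinnedSum-cong M e f χ₁≗ χ₂≗ φ≐ = weightedSum-cong (λ _ → refl) (pin-cong e χ₁≗ (pin-cong f χ₂≗ φ≐))

-- ΔM{e,f}, with the weights of all elements other than e and f given by φ.
rayleighForm : BasisSystem n → Fin n → Fin n → Weight n → ℚ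
rayleighForm M e f φ = P forceIn forceOut * P forceOut forceIn - P forceIn forceIn * P forceOut forceOut
  where P = λ χ₁ χ₂ → pinnedSum M e f χ₁ χ₂ φ

polyWeight-in : ∀ (I J : Subset n) y {c} → lookup I c ≡ true → lookup J c ≡ false →
  ∀ b → polyWeight I J y c b ≡ forceIn b
polyWeight-in I J y c∈I c∉J b rewrite c∈I | c∉J with b
... | true  = refl
... | false = refl

polyWeight-out : ∀ (I J : Subset n) y {c} → lookup I c ≡ false → lookup J c ≡ true →
  ∀ b → polyWeight I J y c b ≡ forceOut b
polyWeight-out I J y c∉I c∈J b rewrite c∉I | c∈J with b
... | true  = refl
... | false = refl

polyWeight-free : ∀ (I J : Subset n) y {c} → lookup I c ≡ false → lookup J c ≡ false →
  ∀ b → polyWeight I J y c b ≡ weightOf y c b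
polyWeight-free I J y c∉I c∉J b rewrite c∉I | c∉J with b
... | true  = refl
... | false = refl

lookup-⁅x⁆ : ∀ (x : Fin n) → lookup ⁅ x ⁆ x ≡ true
lookup-⁅x⁆ x = Vecₚ.[]=⇒lookup (x∈⁅x⁆ x)

lookup-⁅y⁆ : ∀ {x y : Fin n} → x ≢ y → lookup ⁅ y ⁆ x ≡ false
lookup-⁅y⁆ {x = x} {y} x≢y with lookup ⁅ y ⁆ x in eq
... | true  = ⊥-elim (x≢y⇒x∉⁅y⁆ x≢y (Vecₚ.lookup⇒[]= x ⁅ y ⁆ eq))
... | false = refl

Δ≡rayleighForm : ∀ (M : BasisSystem n) {e f} y → e ≢ f → Δ M e f y ≡ rayleighForm M e f (weightOf y)
Δ≡rayleighForm {n} M {e} {f} y e≢f =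
  cong₂ _-_
    (cong₂ _*_
      (asPinned ⁅ e ⁆ ⁅ f ⁆ (polyWeight-in ⁅ e ⁆ ⁅ f ⁆ y e∈e (lookup-⁅y⁆ e≢f))
                            (polyWeight-out ⁅ e ⁆ ⁅ f ⁆ y (lookup-⁅y⁆ f≢e) f∈f)
                (λ c c≢e c≢f → polyWeight-free ⁅ e ⁆ ⁅ f ⁆ y (lookup-⁅y⁆ c≢e) (lookup-⁅y⁆ c≢f)))
      (asPinned ⁅ f ⁆ ⁅ e ⁆ (polyWeight-out ⁅ f ⁆ ⁅ e ⁆ y (lookup-⁅y⁆ e≢f) e∈e)
                            (polyWeight-in ⁅ f ⁆ ⁅ e ⁆ y f∈f (lookup-⁅y⁆ f≢e))
                (λ c c≢e c≢f → polyWeight-free ⁅ f ⁆ ⁅ e ⁆ y (lookup-⁅y⁆ c≢f) (lookup-⁅y⁆ c≢e))))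
    (cong₂ _*_
      (asPinned ef ∅ₛ (polyWeight-in ef ∅ₛ y e∈e∪f ∉∅) (polyWeight-in ef ∅ₛ y f∈e∪f ∉∅)
                (λ c c≢e c≢f → polyWeight-free ef ∅ₛ y (others c≢e c≢f) ∉∅))
      (asPinned ∅ₛ ef (polyWeight-out ∅ₛ ef y ∉∅ e∈e∪f) (polyWeight-out ∅ₛ ef y ∉∅ f∈e∪f)
                (λ c c≢e c≢f → polyWeight-free ∅ₛ ef y ∉∅ (others c≢e c≢f))))
  where
  ef = ⁅ e ⁆ ∪ ⁅ f ⁆
  f≢e = ≢-sym e≢f
  e∈e = lookup-⁅x⁆ e
  f∈f = lookup-⁅x⁆ f
  ∉∅ : ∀ {c} → lookup (∅ₛ {n}) c ≡ false
  ∉∅ {c = c} = Vecₚ.lookup-replicate c false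
  e∈e∪f : lookup ef e ≡ true
  e∈e∪f rewrite Vecₚ.lookup-zipWith _∨_ e ⁅ e ⁆ ⁅ f ⁆ | e∈e = refl
  f∈e∪f : lookup ef f ≡ true
  f∈e∪f rewrite Vecₚ.lookup-zipWith _∨_ f ⁅ e ⁆ ⁅ f ⁆ | f∈f | lookup-⁅y⁆ f≢e = refl
  others : ∀ {c} → c ≢ e → c ≢ f → lookup ef c ≡ false
  others {c} c≢e c≢f rewrite Vecₚ.lookup-zipWith _∨_ c ⁅ e ⁆ ⁅ f ⁆ | lookup-⁅y⁆ c≢e | lookup-⁅y⁆ c≢f = refl
  asPinned : ∀ I J {χ₁ χ₂} → (∀ b → polyWeight I J y e b ≡ χ₁ b) → (∀ b → polyWeight I J y f b ≡ χ₂ b) →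
             (∀ c → c ≢ e → c ≢ f → ∀ b → polyWeight I J y c b ≡ weightOf y c b) →
             genPoly M I J y ≡ pinnedSum M e f χ₁ χ₂ (weightOf y)
  asPinned I J at-e at-f elsewhere =
    trans (genPoly≡basisSum M I J y) (weightedSum-cong (λ _ → refl) (≐-pin₂ _ _ (weightOf y) at-e at-f elsewhere))

basisSum-pin : ∀ (M : BasisSystem n) φ k →
  basisSum M φ ≡ φ k true * basisSum M (pin k forceIn φ) + φ k false * basisSum M (pin k forceOut φ)
basisSum-pin {suc n} M φ k = weightedSum-pin (𝟙 ∘ M) φ k

pinnedSum-linearˡ : ∀ (M : BasisSystem n) e f χ₁ χ₂ φ →
  pinnedSum M e f χ₁ χ₂ φ ≡ χ₁ true * pinnedSum M e f forceIn χ₂ φ + χ₁ false * pinnedSum M e f forceOut χ₂ φ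
pinnedSum-linearˡ M e f χ₁ χ₂ φ =
  trans (basisSum-pin M (pin e χ₁ (pin f χ₂ φ)) e)
        (cong₂ _+_ (cong₂ _*_ (pin-here e χ₁ _ refl true)  (weightedSum-cong (λ _ → refl) (pin-pin e forceIn χ₁ _)))
                   (cong₂ _*_ (pin-here e χ₁ _ refl false) (weightedSum-cong (λ _ → refl) (pin-pin e forceOut χ₁ _))))

pinnedSum-linearʳ : ∀ (M : BasisSystem n) {e f} χ₁ χ₂ φ → e ≢ f →
  pinnedSum M e f χ₁ χ₂ φ ≡ χ₂ true * pinnedSum M e f χ₁ forceIn φ + χ₂ false * pinnedSum M e f χ₁ forceOut φ
pinnedSum-linearʳ M {e} {f} χ₁ χ₂ φ e≢f =
  trans (basisSum-pin M (pin e χ₁ (pin f χ₂ φ)) f)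
        (cong₂ _+_ (cong₂ _*_ (at-f true)  (weightedSum-cong (λ _ → refl) (repin forceIn)))
                   (cong₂ _*_ (at-f false) (weightedSum-cong (λ _ → refl) (repin forceOut))))
  where
  at-f : ∀ b → pin e χ₁ (pin f χ₂ φ) f b ≡ χ₂ b
  at-f b = trans (pin-there e χ₁ _ (≢-sym e≢f) b) (pin-here f χ₂ φ refl b)
  repin : ∀ χ → pin f χ (pin e χ₁ (pin f χ₂ φ)) ≐ pin e χ₁ (pin f χ φ)
  repin χ c b = trans (pin-comm χ₁ χ _ e≢f c b) (pin-cong e (λ _ → refl) (pin-pin f χ χ₂ φ) c b)

pinnedSum-bilinear : ∀ (M : BasisSystem n) {e f} χ₁ χ₂ φ → e ≢ f →
  pinnedSum M e f χ₁ χ₂ φ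
  ≡ χ₁ true  * (χ₂ true * pinnedSum M e f forceIn forceIn φ  + χ₂ false * pinnedSum M e f forceIn forceOut φ)
  + χ₁ false * (χ₂ true * pinnedSum M e f forceOut forceIn φ + χ₂ false * pinnedSum M e f forceOut forceOut φ)
pinnedSum-bilinear M {e} {f} χ₁ χ₂ φ e≢f =
  trans (pinnedSum-linearˡ M e f χ₁ χ₂ φ)
        (cong₂ _+_ (cong (χ₁ true *_)  (pinnedSum-linearʳ M forceIn χ₂ φ e≢f))
                   (cong (χ₁ false *_) (pinnedSum-linearʳ M forceOut χ₂ φ e≢f)))

-- Parallel extensions

weightedSum-++ : ∀ a {b} (G : Subset (a ℕ.+ b) → ℚ) φ →
  weightedSum G φ ≡ weightedSum (λ T → weightedSum (λ U → G (T Vec.++ U)) (φ ∘ (a ↑ʳ_))) (φ ∘ (_↑ˡ b))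
weightedSum-++ zero    G φ = refl
weightedSum-++ (suc a) G φ =
  cong₂ _+_ (cong (φ zero true *_)  (weightedSum-++ a (λ S → G (true ∷ S)) (φ ∘ suc)))
            (cong (φ zero false *_) (weightedSum-++ a (λ S → G (false ∷ S)) (φ ∘ suc)))

anyFin allFin : (Fin n → Bool) → Bool
anyFin {zero}  g = false
anyFin {suc n} g = g zero ∨ anyFin (g ∘ suc)
allFin {zero}  g = true
allFin {suc n} g = g zero ∧ allFin (g ∘ suc)

any-tabulate : ∀ {m} (g : Fin n → Bool) (h : Fin m → Fin n) → anyᵇ g (List.tabulate h) ≡ anyFin (g ∘ h)
any-tabulate {m = zero}  g h = refl
any-tabulate {m = suc m} g h = cong (g (h zero) ∨_) (any-tabulate g (h ∘ suc))

all-tabulate : ∀ {m} (g : Fin n → Bool) (h : Fin m → Fin n) → allᵇ g (List.tabulate h) ≡ allFin (g ∘ h)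
all-tabulate {m = zero}  g h = refl
all-tabulate {m = suc m} g h = cong (g (h zero) ∧_) (all-tabulate g (h ∘ suc))

anyFin-cong : ∀ {g h : Fin n → Bool} → (∀ c → g c ≡ h c) → anyFin g ≡ anyFin h
anyFin-cong {zero}  g≗h = refl
anyFin-cong {suc n} g≗h = cong₂ _∨_ (g≗h zero) (anyFin-cong (g≗h ∘ suc))

allFin-cong : ∀ {g h : Fin n → Bool} → (∀ c → g c ≡ h c) → allFin g ≡ allFin h
allFin-cong {zero}  g≗h = refl
allFin-cong {suc n} g≗h = cong₂ _∧_ (g≗h zero) (allFin-cong (g≗h ∘ suc))

anyFin-false : anyFin {n} (λ _ → false) ≡ false
anyFin-false {zero}  = refl
anyFin-false {suc n} = anyFin-false {n}

anyFin-++ : ∀ a {b} (g : Fin (a ℕ.+ b) → Bool) → anyFin g ≡ anyFin (g ∘ (_↑ˡ b)) ∨ anyFin (g ∘ (a ↑ʳ_))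
anyFin-++ zero    g = refl
anyFin-++ (suc a) g = trans (cong (g zero ∨_) (anyFin-++ a (g ∘ suc))) (sym (∨-assoc (g zero) _ _))

tabulate-++ : ∀ {A : Set} a {b} (g : Fin (a ℕ.+ b) → A) →
              tabulate g ≡ tabulate (g ∘ (_↑ˡ b)) Vec.++ tabulate (g ∘ (a ↑ʳ_))
tabulate-++ zero    g = refl
tabulate-++ (suc a) g = cong (g zero ∷_) (tabulate-++ a (g ∘ suc))

∣++∣ : ∀ {a b} (T : Subset a) (U : Subset b) → ∣ T Vec.++ U ∣ ≡ ∣ T ∣ ℕ.+ ∣ U ∣
∣++∣ []          U = refl
∣++∣ (true ∷ T)  U = cong suc (∣++∣ T U)
∣++∣ (false ∷ T) U = ∣++∣ T U

∣tabulate-false∣ : ∣ tabulate {n = n} (λ _ → false) ∣ ≡ 0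
∣tabulate-false∣ {zero}  = refl
∣tabulate-false∣ {suc n} = ∣tabulate-false∣ {n}

⌊suc≟suc⌋ : ∀ (x y : Fin n) → ⌊ suc x ≟ suc y ⌋ ≡ ⌊ x ≟ y ⌋
⌊suc≟suc⌋ x y with x ≟ y
... | yes _ = refl
... | no _  = refl

parent-↑ˡ : ∀ m₀ (ms : Vec ℕ n) k → parent (m₀ ∷ ms) (k ↑ˡ Vec.sum ms) ≡ zero
parent-↑ˡ m₀ ms k rewrite splitAt-↑ˡ m₀ k (Vec.sum ms) = refl

parent-↑ʳ : ∀ m₀ (ms : Vec ℕ n) k → parent (m₀ ∷ ms) (m₀ ↑ʳ k) ≡ suc (parent ms k)
parent-↑ʳ m₀ ms k rewrite splitAt-↑ʳ m₀ (Vec.sum ms) k = refl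

module _ {n} (m₀ : ℕ) (ms : Vec ℕ n) (T : Subset m₀) (U : Subset (Vec.sum ms)) where

  private
    inClass : Fin (suc n) → Fin (m₀ ℕ.+ Vec.sum ms) → Bool
    inClass e k = lookup (T Vec.++ U) k ∧ ⌊ parent (m₀ ∷ ms) k ≟ e ⌋

    inClass-↑ˡ-zero : ∀ k → inClass zero (k ↑ˡ Vec.sum ms) ≡ lookup T k
    inClass-↑ˡ-zero k rewrite Vecₚ.lookup-++ˡ T U k | parent-↑ˡ m₀ ms k = ∧-identityʳ _

    inClass-↑ʳ-zero : ∀ k → inClass zero (m₀ ↑ʳ k) ≡ false
    inClass-↑ʳ-zero k rewrite Vecₚ.lookup-++ʳ T U k | parent-↑ʳ m₀ ms k = ∧-zeroʳ _

    inClass-↑ˡ-suc : ∀ e k → inClass (suc e) (k ↑ˡ Vec.sum ms) ≡ false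
    inClass-↑ˡ-suc e k rewrite Vecₚ.lookup-++ˡ T U k | parent-↑ˡ m₀ ms k = ∧-zeroʳ _

    inClass-↑ʳ-suc : ∀ e k → inClass (suc e) (m₀ ↑ʳ k) ≡ lookup U k ∧ ⌊ parent ms k ≟ e ⌋
    inClass-↑ʳ-suc e k rewrite Vecₚ.lookup-++ʳ T U k | parent-↑ʳ m₀ ms k | ⌊suc≟suc⌋ (parent ms k) e = refl

  image-++ : image (m₀ ∷ ms) (T Vec.++ U) ≡ anyFin (lookup T) ∷ image ms U
  image-++ = cong₂ _∷_ first (Vecₚ.tabulate-cong rest)
    where
    first : anyᵇ (inClass zero) (List.allFin _) ≡ anyFin (lookup T)
    first = begin
      anyᵇ (inClass zero) (List.allFin _)
        ≡⟨ trans (any-tabulate (inClass zero) (λ c → c)) (anyFin-++ m₀ (inClass zero)) ⟩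
      anyFin (inClass zero ∘ (_↑ˡ Vec.sum ms)) ∨ anyFin (inClass zero ∘ (m₀ ↑ʳ_))
        ≡⟨ cong₂ _∨_ (anyFin-cong inClass-↑ˡ-zero) (trans (anyFin-cong inClass-↑ʳ-zero) (anyFin-false {Vec.sum ms})) ⟩
      anyFin (lookup T) ∨ false
        ≡⟨ ∨-identityʳ _ ⟩
      anyFin (lookup T) ∎
      where open ≡-Reasoning
    rest : ∀ e → anyᵇ (inClass (suc e)) (List.allFin _)
               ≡ anyᵇ (λ k → lookup U k ∧ ⌊ parent ms k ≟ e ⌋) (List.allFin _)
    rest e = begin
      anyᵇ (inClass (suc e)) (List.allFin _)
        ≡⟨ trans (any-tabulate (inClass (suc e)) (λ c → c)) (anyFin-++ m₀ (inClass (suc e))) ⟩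
      anyFin (inClass (suc e) ∘ (_↑ˡ Vec.sum ms)) ∨ anyFin (inClass (suc e) ∘ (m₀ ↑ʳ_))
        ≡⟨ cong₂ _∨_ (trans (anyFin-cong (inClass-↑ˡ-suc e)) (anyFin-false {m₀})) (anyFin-cong (inClass-↑ʳ-suc e)) ⟩
      anyFin (λ k → lookup U k ∧ ⌊ parent ms k ≟ e ⌋)
        ≡⟨ sym (any-tabulate (λ k → lookup U k ∧ ⌊ parent ms k ≟ e ⌋) (λ c → c)) ⟩
      anyᵇ (λ k → lookup U k ∧ ⌊ parent ms k ≟ e ⌋) (List.allFin _) ∎
      where open ≡-Reasoning

  ∣fibre-++∣-zero : ∣ fibre (m₀ ∷ ms) (T Vec.++ U) zero ∣ ≡ ∣ T ∣
  ∣fibre-++∣-zero = begin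
    ∣ tabulate (inClass zero) ∣
      ≡⟨ trans (cong ∣_∣ (tabulate-++ m₀ (inClass zero)))
               (∣++∣ (tabulate (inClass zero ∘ (_↑ˡ Vec.sum ms))) (tabulate (inClass zero ∘ (m₀ ↑ʳ_)))) ⟩
    ∣ tabulate (inClass zero ∘ (_↑ˡ Vec.sum ms)) ∣ ℕ.+ ∣ tabulate (inClass zero ∘ (m₀ ↑ʳ_)) ∣
      ≡⟨ cong₂ ℕ._+_ (cong ∣_∣ (trans (Vecₚ.tabulate-cong inClass-↑ˡ-zero) (Vecₚ.tabulate∘lookup T)))
                     (trans (cong ∣_∣ (Vecₚ.tabulate-cong inClass-↑ʳ-zero)) (∣tabulate-false∣ {Vec.sum ms})) ⟩
    ∣ T ∣ ℕ.+ 0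
      ≡⟨ ℕP.+-identityʳ _ ⟩
    ∣ T ∣ ∎
    where open ≡-Reasoning

  ∣fibre-++∣-suc : ∀ e → ∣ fibre (m₀ ∷ ms) (T Vec.++ U) (suc e) ∣ ≡ ∣ fibre ms U e ∣
  ∣fibre-++∣-suc e = begin
    ∣ tabulate (inClass (suc e)) ∣
      ≡⟨ trans (cong ∣_∣ (tabulate-++ m₀ (inClass (suc e))))
               (∣++∣ (tabulate (inClass (suc e) ∘ (_↑ˡ Vec.sum ms))) (tabulate (inClass (suc e) ∘ (m₀ ↑ʳ_)))) ⟩
    ∣ tabulate (inClass (suc e) ∘ (_↑ˡ Vec.sum ms)) ∣ ℕ.+ ∣ tabulate (inClass (suc e) ∘ (m₀ ↑ʳ_)) ∣
      ≡⟨ cong₂ ℕ._+_ (trans (cong ∣_∣ (Vecₚ.tabulate-cong (inClass-↑ˡ-suc e))) (∣tabulate-false∣ {m₀}))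
                     (cong ∣_∣ (Vecₚ.tabulate-cong (inClass-↑ʳ-suc e))) ⟩
    ∣ fibre ms U e ∣ ∎
    where open ≡-Reasoning

parallelExt-++ : ∀ (M : BasisSystem (suc n)) m₀ (ms : Vec ℕ n) T U →
  parallelExt M (m₀ ∷ ms) (T Vec.++ U) ≡ ⌊ ∣ T ∣ ℕ.≤? 1 ⌋ ∧ parallelExt (λ S → M (anyFin (lookup T) ∷ S)) ms U
parallelExt-++ {n} M m₀ ms T U = begin
  M (image (m₀ ∷ ms) (T Vec.++ U)) ∧ allᵇ atMostOne (List.allFin (suc n))
    ≡⟨ cong₂ _∧_ (cong M (image-++ m₀ ms T U)) (all-tabulate atMostOne (λ c → c)) ⟩
  M (anyFin (lookup T) ∷ image ms U) ∧ (atMostOne zero ∧ allFin (atMostOne ∘ suc))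
    ≡⟨ cong (λ b → M (anyFin (lookup T) ∷ image ms U) ∧ b)
            (cong₂ _∧_ (cong (λ k → ⌊ k ℕ.≤? 1 ⌋) (∣fibre-++∣-zero m₀ ms T U))
                       (trans (allFin-cong (λ e → cong (λ k → ⌊ k ℕ.≤? 1 ⌋) (∣fibre-++∣-suc m₀ ms T U e)))
                              (sym (all-tabulate (λ e → ⌊ ∣ fibre ms U e ∣ ℕ.≤? 1 ⌋) (λ c → c))))) ⟩
  M (anyFin (lookup T) ∷ image ms U) ∧ (⌊ ∣ T ∣ ℕ.≤? 1 ⌋ ∧ allᵇ (λ e → ⌊ ∣ fibre ms U e ∣ ℕ.≤? 1 ⌋) (List.allFin n))
    ≡⟨ ∧-swap (M (anyFin (lookup T) ∷ image ms U)) ⌊ ∣ T ∣ ℕ.≤? 1 ⌋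
              (allᵇ (λ e → ⌊ ∣ fibre ms U e ∣ ℕ.≤? 1 ⌋) (List.allFin n)) ⟩
  ⌊ ∣ T ∣ ℕ.≤? 1 ⌋ ∧ parallelExt (λ S → M (anyFin (lookup T) ∷ S)) ms U ∎
  where
  open ≡-Reasoning
  atMostOne : Fin (suc n) → Bool
  atMostOne e = ⌊ ∣ fibre (m₀ ∷ ms) (T Vec.++ U) e ∣ ℕ.≤? 1 ⌋

classOut : ∀ a → Weight a → ℚ
classOut a χ = ∏ (λ k → χ k false)

classIn : ∀ a → Weight a → ℚ
classIn zero    χ = 0ℚ
classIn (suc a) χ = χ zero true * classOut a (χ ∘ suc) + χ zero false * classIn a (χ ∘ suc)

-- A class of a parallel copies meets a basis of the extension in one copy (classIn) or in none (classOut).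
classWeight : ∀ a → Weight a → Bool → ℚ
classWeight a χ b = if b then classIn a χ else classOut a χ

copy : (m : Vec ℕ n) (c : Fin n) → Fin (lookup m c) → Fin (Vec.sum m)
copy (m₀ ∷ ms) zero    k = k ↑ˡ Vec.sum ms
copy (m₀ ∷ ms) (suc c) k = m₀ ↑ʳ copy ms c k

collapse : (m : Vec ℕ n) → Weight (Vec.sum m) → Weight n
collapse m φ c = classWeight (lookup m c) (φ ∘ copy m c)

-- The guard ∣ T ∣ < 1 is written as it arises in the proof of weightedSum-atMostOne.
weightedSum-empty : ∀ a (χ : Weight a) x →
  weightedSum (λ T → if ⌊ suc ∣ T ∣ ℕ.≤? 1 ⌋ then x else 0ℚ) χ ≡ x * classOut a χ
weightedSum-empty zero    χ x = sym (ℚP.*-identityʳ x)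
weightedSum-empty (suc a) χ x
  rewrite weightedSum-zero (χ ∘ suc) (λ _ → refl) | weightedSum-empty a (χ ∘ suc) x =
  solve 4 (λ t f x p → t :* con 0ℚ :+ f :* (x :* p) := x :* (f :* p)) refl
    (χ zero true) (χ zero false) x (classOut a (χ ∘ suc))

weightedSum-atMostOne : ∀ a (χ : Weight a) (H : Bool → ℚ) →
  weightedSum (λ T → if ⌊ ∣ T ∣ ℕ.≤? 1 ⌋ then H (anyFin (lookup T)) else 0ℚ) χ
  ≡ classIn a χ * H true + classOut a χ * H false
weightedSum-atMostOne zero    χ H = solve 2 (λ t f → f := con 0ℚ :* t :+ con 1ℚ :* f) refl (H true) (H false)
weightedSum-atMostOne (suc a) χ H
  rewrite weightedSum-empty a (χ ∘ suc) (H true) | weightedSum-atMostOne a (χ ∘ suc) H =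
  solve 6 (λ t f x y i o → t :* (x :* o) :+ f :* (i :* x :+ o :* y) := (t :* o :+ f :* i) :* x :+ (f :* o) :* y) refl
    (χ zero true) (χ zero false) (H true) (H false) (classIn a (χ ∘ suc)) (classOut a (χ ∘ suc))

basisSum-parallelExt : ∀ (M : BasisSystem n) m φ → basisSum (parallelExt M m) φ ≡ basisSum M (collapse m φ)
basisSum-parallelExt M []         φ = cong 𝟙 (∧-identityʳ (M []))
basisSum-parallelExt M (m₀ ∷ ms) φ = begin
  basisSum (parallelExt M (m₀ ∷ ms)) φ
    ≡⟨ weightedSum-++ m₀ _ φ ⟩
  weightedSum (λ T → weightedSum (λ U → 𝟙 (parallelExt M (m₀ ∷ ms) (T Vec.++ U))) φʳ) φˡ
    ≡⟨ weightedSum-cong inner (λ _ _ → refl) ⟩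
  weightedSum (λ T → if ⌊ ∣ T ∣ ℕ.≤? 1 ⌋ then H (anyFin (lookup T)) else 0ℚ) φˡ
    ≡⟨ weightedSum-atMostOne m₀ φˡ H ⟩
  basisSum M (collapse (m₀ ∷ ms) φ) ∎
  where
  open ≡-Reasoning
  φˡ = φ ∘ (_↑ˡ Vec.sum ms)
  φʳ = φ ∘ (m₀ ↑ʳ_)
  H : Bool → ℚ
  H b = basisSum (λ S → M (b ∷ S)) (collapse ms φʳ)
  M′ : ∀ T → BasisSystem _
  M′ T S = M (anyFin (lookup T) ∷ S)
  inner : ∀ T → weightedSum (λ U → 𝟙 (parallelExt M (m₀ ∷ ms) (T Vec.++ U))) φʳ
              ≡ (if ⌊ ∣ T ∣ ℕ.≤? 1 ⌋ then H (anyFin (lookup T)) else 0ℚ)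
  inner T with ⌊ ∣ T ∣ ℕ.≤? 1 ⌋ in eq
  ... | true  = trans (weightedSum-cong (λ U → cong 𝟙 (trans (parallelExt-++ M m₀ ms T U) (cong (_∧ parallelExt (M′ T) ms U) eq)))
                                        (λ _ _ → refl))
                      (basisSum-parallelExt (M′ T) ms φʳ)
  ... | false = weightedSum-zero φʳ (λ U → cong 𝟙 (trans (parallelExt-++ M m₀ ms T U) (cong (_∧ parallelExt (M′ T) ms U) eq)))

parent-copy : ∀ (m : Vec ℕ n) c k → parent m (copy m c k) ≡ c
parent-copy (m₀ ∷ ms) zero    k = parent-↑ˡ m₀ ms k
parent-copy (m₀ ∷ ms) (suc c) k = trans (parent-↑ʳ m₀ ms (copy ms c k)) (cong suc (parent-copy ms c k))

copy-injective : ∀ (m : Vec ℕ n) c {j k} → copy m c j ≡ copy m c k → j ≡ k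
copy-injective (m₀ ∷ ms) zero    eq = ↑ˡ-injective (Vec.sum ms) _ _ eq
copy-injective (m₀ ∷ ms) (suc c) eq = copy-injective ms c (↑ʳ-injective m₀ _ _ eq)

copy-surjective : ∀ (m : Vec ℕ n) k → Σ (Fin (lookup m (parent m k))) λ j → copy m (parent m k) j ≡ k
copy-surjective (m₀ ∷ ms) k with splitAt m₀ k in eq
... | inj₁ j  = j , splitAt⁻¹-↑ˡ eq
... | inj₂ k′ with copy-surjective ms k′
...   | j , p = j , trans (cong (m₀ ↑ʳ_) p) (splitAt⁻¹-↑ʳ eq)

pin-copy-same : ∀ (m : Vec ℕ n) c j χ φ → (pin (copy m c j) χ φ ∘ copy m c) ≐ pin j χ (φ ∘ copy m c)
pin-copy-same m c j χ φ = ≐-pin j χ (φ ∘ copy m c) (pin-here (copy m c j) χ φ refl)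
  (λ k k≢j → pin-there (copy m c j) χ φ (k≢j ∘ copy-injective m c))

pin-copy-other : ∀ (m : Vec ℕ n) {c d} j χ φ → d ≢ c → (pin (copy m c j) χ φ ∘ copy m d) ≐ (φ ∘ copy m d)
pin-copy-other m {c} {d} j χ φ d≢c k =
  pin-there (copy m c j) χ φ (λ eq → d≢c (trans (sym (parent-copy m d k)) (trans (cong (parent m) eq) (parent-copy m c j))))

classOut-cong : ∀ a {χ χ′ : Weight a} → χ ≐ χ′ → classOut a χ ≡ classOut a χ′
classOut-cong zero    χ≐χ′ = refl
classOut-cong (suc a) χ≐χ′ = cong₂ _*_ (χ≐χ′ zero false) (classOut-cong a (χ≐χ′ ∘ suc))

classIn-cong : ∀ a {χ χ′ : Weight a} → χ ≐ χ′ → classIn a χ ≡ classIn a χ′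
classIn-cong zero    χ≐χ′ = refl
classIn-cong (suc a) χ≐χ′ =
  cong₂ _+_ (cong₂ _*_ (χ≐χ′ zero true) (classOut-cong a (χ≐χ′ ∘ suc)))
            (cong₂ _*_ (χ≐χ′ zero false) (classIn-cong a (χ≐χ′ ∘ suc)))

classWeight-cong : ∀ a {χ χ′ : Weight a} → χ ≐ χ′ → ∀ b → classWeight a χ b ≡ classWeight a χ′ b
classWeight-cong a χ≐χ′ true  = classIn-cong a χ≐χ′
classWeight-cong a χ≐χ′ false = classOut-cong a χ≐χ′

collapse-pin : ∀ (m : Vec ℕ n) c j χ φ →
  collapse m (pin (copy m c j) χ φ) ≐ pin c (classWeight (lookup m c) (pin j χ (φ ∘ copy m c))) (collapse m φ)
collapse-pin m c j χ φ = ≐-pin c _ (collapse m φ)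
  (classWeight-cong (lookup m c) (pin-copy-same m c j χ φ))
  (λ d d≢c → classWeight-cong (lookup m d) (pin-copy-other m j χ φ d≢c))

classOut-expand : ∀ a (j : Fin (suc a)) (χ : Weight (suc a)) →
  classOut (suc a) χ ≡ χ j false * classOut a (χ ∘ punchIn j)
classOut-expand a       zero    χ = refl
classOut-expand (suc a) (suc j) χ rewrite classOut-expand a j (χ ∘ suc) =
  solve 3 (λ x y p → x :* (y :* p) := y :* (x :* p)) refl (χ zero false) (χ (suc j) false) _

classIn-expand : ∀ a (j : Fin (suc a)) (χ : Weight (suc a)) →
  classIn (suc a) χ ≡ χ j true * classOut a (χ ∘ punchIn j) + χ j false * classIn a (χ ∘ punchIn j)
classIn-expand a       zero    χ = refl
classIn-expand (suc a) (suc j) χ rewrite classOut-expand a j (χ ∘ suc) | classIn-expand a j (χ ∘ suc) =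
  solve 6 (λ t₀ f₀ t f o i → t₀ :* (f :* o) :+ f₀ :* (t :* o :+ f :* i)
                          := t :* (f₀ :* o) :+ f :* (t₀ :* o :+ f₀ :* i)) refl
    (χ zero true) (χ zero false) (χ (suc j) true) (χ (suc j) false) _ _

Normalised : Weight n → Set
Normalised φ = ∀ c → φ c false ≡ 1ℚ

classOut-normalised : ∀ a (χ : Weight a) → Normalised χ → classOut a χ ≡ 1ℚ
classOut-normalised zero    χ χ₁ = refl
classOut-normalised (suc a) χ χ₁ =
  trans (cong₂ _*_ (χ₁ zero) (classOut-normalised a (χ ∘ suc) (χ₁ ∘ suc))) (ℚP.*-identityˡ 1ℚ)

othersIn : ∀ a → Fin a → Weight a → ℚ
othersIn (suc a) j χ = classIn a (χ ∘ punchIn j)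

-- The collapsed weight of a class one of whose copies is pinned to χ, the other copies contributing R.
withOthers : (Bool → ℚ) → ℚ → Bool → ℚ
withOthers χ R b = if b then χ true + χ false * R else χ false

classWeight-pin : ∀ a (j : Fin a) χ {ψ} → Normalised ψ → ∀ b →
                  classWeight a (pin j χ ψ) b ≡ withOthers χ (othersIn a j ψ) b
classWeight-pin (suc a) j χ {ψ} ψ₁ true = begin
  classIn (suc a) (pin j χ ψ)
    ≡⟨ classIn-expand a j (pin j χ ψ) ⟩
  pin j χ ψ j true * classOut a (pin j χ ψ ∘ punchIn j) + pin j χ ψ j false * classIn a (pin j χ ψ ∘ punchIn j)
    ≡⟨ cong₂ _+_ (cong₂ _*_ (pin-here j χ ψ refl true) (trans (classOut-cong a others) rest₁))
                 (cong₂ _*_ (pin-here j χ ψ refl false) (classIn-cong a others)) ⟩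
  χ true * 1ℚ + χ false * classIn a (ψ ∘ punchIn j)
    ≡⟨ cong (_+ χ false * classIn a (ψ ∘ punchIn j)) (ℚP.*-identityʳ (χ true)) ⟩
  χ true + χ false * classIn a (ψ ∘ punchIn j) ∎
  where
  open ≡-Reasoning
  others : (pin j χ ψ ∘ punchIn j) ≐ (ψ ∘ punchIn j)
  others k = pin-there j χ ψ (punchInᵢ≢i j k)
  rest₁ = classOut-normalised a (ψ ∘ punchIn j) (ψ₁ ∘ punchIn j)
classWeight-pin (suc a) j χ {ψ} ψ₁ false = begin
  classOut (suc a) (pin j χ ψ)
    ≡⟨ classOut-expand a j (pin j χ ψ) ⟩
  pin j χ ψ j false * classOut a (pin j χ ψ ∘ punchIn j)
    ≡⟨ cong₂ _*_ (pin-here j χ ψ refl false)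
                 (trans (classOut-cong a (λ k → pin-there j χ ψ (punchInᵢ≢i j k)))
                        (classOut-normalised a (ψ ∘ punchIn j) (ψ₁ ∘ punchIn j))) ⟩
  χ false * 1ℚ
    ≡⟨ ℚP.*-identityʳ (χ false) ⟩
  χ false ∎
  where open ≡-Reasoning

pinnedSum-parallelExt : ∀ (M : BasisSystem n) m {e f} (j : Fin (lookup m e)) (j′ : Fin (lookup m f)) χ₁ χ₂ {φ} →
  e ≢ f → Normalised φ →
  pinnedSum (parallelExt M m) (copy m e j) (copy m f j′) χ₁ χ₂ φ
  ≡ pinnedSum M e f (withOthers χ₁ (othersIn _ j (φ ∘ copy m e))) (withOthers χ₂ (othersIn _ j′ (φ ∘ copy m f)))
                    (collapse m φ)
pinnedSum-parallelExt M m {e} {f} j j′ χ₁ χ₂ {φ} e≢f φ₁ =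
  trans (basisSum-parallelExt M m _) (weightedSum-cong (λ _ → refl) collapse≐)
  where
  collapse≐ : collapse m (pin (copy m e j) χ₁ (pin (copy m f j′) χ₂ φ))
            ≐ pin e (withOthers χ₁ (othersIn _ j (φ ∘ copy m e)))
                    (pin f (withOthers χ₂ (othersIn _ j′ (φ ∘ copy m f))) (collapse m φ))
  collapse≐ c b = trans (collapse-pin m e j χ₁ _ c b)
    (pin-cong e (λ b′ → trans (classWeight-cong _ (pin-cong j (λ _ → refl) (pin-copy-other m j′ χ₂ φ e≢f)) b′)
                              (classWeight-pin _ j χ₁ (φ₁ ∘ copy m e) b′))
                (λ c′ b′ → trans (collapse-pin m f j′ χ₂ φ c′ b′)
                                 (pin-cong f (classWeight-pin _ j′ χ₂ (φ₁ ∘ copy m f)) (λ _ _ → refl) c′ b′)) c b)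

rayleighForm-withOthers : ∀ (M : BasisSystem n) {e f} R₁ R₂ φ → e ≢ f →
  let P = λ χ₁ χ₂ → pinnedSum M e f (withOthers χ₁ R₁) (withOthers χ₂ R₂) φ in
  P forceIn forceOut * P forceOut forceIn - P forceIn forceIn * P forceOut forceOut ≡ rayleighForm M e f φ
rayleighForm-withOthers M {e} {f} R₁ R₂ φ e≢f
  rewrite pinnedSum-bilinear M (withOthers forceIn R₁)  (withOthers forceOut R₂) φ e≢f
        | pinnedSum-bilinear M (withOthers forceOut R₁) (withOthers forceIn R₂)  φ e≢f
        | pinnedSum-bilinear M (withOthers forceIn R₁)  (withOthers forceIn R₂)  φ e≢f
        | pinnedSum-bilinear M (withOthers forceOut R₁) (withOthers forceOut R₂) φ e≢f =
  solve 6 (λ r₁ r₂ ii io oi oo →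
      let in₁ = con 1ℚ :+ con 0ℚ :* r₁ ; out₁ = con 0ℚ :+ con 1ℚ :* r₁
          in₂ = con 1ℚ :+ con 0ℚ :* r₂ ; out₂ = con 0ℚ :+ con 1ℚ :* r₂
          P = λ t₁ f₁ t₂ f₂ → t₁ :* (t₂ :* ii :+ f₂ :* io) :+ f₁ :* (t₂ :* oi :+ f₂ :* oo)
      in P in₁ (con 0ℚ) out₂ (con 1ℚ) :* P out₁ (con 1ℚ) in₂ (con 0ℚ)
         :- P in₁ (con 0ℚ) in₂ (con 0ℚ) :* P out₁ (con 1ℚ) out₂ (con 1ℚ)
      := io :* oi :- ii :* oo) refl
    R₁ R₂ (pinnedSum M e f forceIn forceIn φ) (pinnedSum M e f forceIn forceOut φ)
          (pinnedSum M e f forceOut forceIn φ) (pinnedSum M e f forceOut forceOut φ)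

rayleighForm-parallelExt : ∀ (M : BasisSystem n) m {e f} (j : Fin (lookup m e)) (j′ : Fin (lookup m f)) {φ} →
  e ≢ f → Normalised φ → rayleighForm (parallelExt M m) (copy m e j) (copy m f j′) φ ≡ rayleighForm M e f (collapse m φ)
rayleighForm-parallelExt M m {e} {f} j j′ {φ} e≢f φ₁ =
  trans (cong₂ _-_ (cong₂ _*_ (collapsed forceIn forceOut) (collapsed forceOut forceIn))
                   (cong₂ _*_ (collapsed forceIn forceIn)  (collapsed forceOut forceOut)))
        (rayleighForm-withOthers M (othersIn _ j (φ ∘ copy m e)) (othersIn _ j′ (φ ∘ copy m f)) (collapse m φ) e≢f)
  where collapsed = λ χ₁ χ₂ → pinnedSum-parallelExt M m j j′ χ₁ χ₂ {φ} e≢f φ₁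

classOut-zero : ∀ a (k : Fin a) χ → χ k false ≡ 0ℚ → classOut a χ ≡ 0ℚ
classOut-zero (suc a) zero    χ χₖ≡0 = trans (cong (_* classOut a (χ ∘ suc)) χₖ≡0) (ℚP.*-zeroˡ (classOut a (χ ∘ suc)))
classOut-zero (suc a) (suc k) χ χₖ≡0 =
  trans (cong (χ zero false *_) (classOut-zero a k (χ ∘ suc) χₖ≡0)) (ℚP.*-zeroʳ (χ zero false))

-- No basis of a parallel extension contains two copies of the same element.
classWeight-twoForced : ∀ a {j j′ : Fin a} χ → j ≢ j′ → ∀ b → classWeight a (pin j forceIn (pin j′ forceIn χ)) b ≡ 0ℚ
classWeight-twoForced (suc a) {j} {j′} χ j≢j′ true = begin
  classIn (suc a) ψ
    ≡⟨ classIn-expand a j ψ ⟩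
  ψ j true * classOut a (ψ ∘ punchIn j) + ψ j false * classIn a (ψ ∘ punchIn j)
    ≡⟨ cong₂ _+_ (cong (ψ j true *_) (classOut-zero a (punchOut j≢j′) (ψ ∘ punchIn j) j′-forced))
                 (cong (_* classIn a (ψ ∘ punchIn j)) (pin-here j forceIn _ refl false)) ⟩
  ψ j true * 0ℚ + 0ℚ * classIn a (ψ ∘ punchIn j)
    ≡⟨ solve 2 (λ x y → x :* con 0ℚ :+ con 0ℚ :* y := con 0ℚ) refl (ψ j true) (classIn a (ψ ∘ punchIn j)) ⟩
  0ℚ ∎
  where
  open ≡-Reasoning
  ψ = pin j forceIn (pin j′ forceIn χ)
  j′-forced : ψ (punchIn j (punchOut j≢j′)) false ≡ 0ℚ
  j′-forced rewrite punchIn-punchOut j≢j′ =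
    trans (pin-there j forceIn _ (j≢j′ ∘ sym) false) (pin-here j′ forceIn χ refl false)
classWeight-twoForced (suc a) {j} {j′} χ j≢j′ false =
  classOut-zero (suc a) j (pin j forceIn (pin j′ forceIn χ)) (pin-here j forceIn (pin j′ forceIn χ) refl false)

basisSum-zeroAt : ∀ (M : BasisSystem n) φ c → (∀ b → φ c b ≡ 0ℚ) → basisSum M φ ≡ 0ℚ
basisSum-zeroAt M φ c φc≡0 =
  trans (basisSum-pin M φ c) (trans (cong₂ _+_ (vanishes forceIn true) (vanishes forceOut false)) (ℚP.+-identityʳ 0ℚ))
  where
  vanishes : ∀ χ b → φ c b * basisSum M (pin c χ φ) ≡ 0ℚ
  vanishes χ b = trans (cong (_* basisSum M (pin c χ φ)) (φc≡0 b)) (ℚP.*-zeroˡ (basisSum M (pin c χ φ)))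

pinnedSum-parallelExt-sameClass : ∀ (M : BasisSystem n) m c {j j′ : Fin (lookup m c)} φ → j ≢ j′ →
  pinnedSum (parallelExt M m) (copy m c j) (copy m c j′) forceIn forceIn φ ≡ 0ℚ
pinnedSum-parallelExt-sameClass M m c {j} {j′} φ j≢j′ =
  trans (basisSum-parallelExt M m _) (basisSum-zeroAt M _ c λ b →
    trans (collapse-pin m c j forceIn _ c b)
    (trans (pin-here c _ _ refl b)
    (trans (classWeight-cong _ (pin-cong j (λ _ → refl) (pin-copy-same m c j′ forceIn φ)) b)
           (classWeight-twoForced _ (φ ∘ copy m c) j≢j′ b))))

0≤1 : 0ℚ ≤ 1ℚ
0≤1 = ℚP.<⇒≤ (ℚP.positive⁻¹ 1ℚ)

*-nonNeg : ∀ {p q} → 0ℚ ≤ p → 0ℚ ≤ q → 0ℚ ≤ p * q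
*-nonNeg {p} {q} 0≤p 0≤q =
  ℚP.nonNegative⁻¹ _ {{ℚP.nonNeg*nonNeg⇒nonNeg p {{ℚ.nonNegative 0≤p}} q {{ℚ.nonNegative 0≤q}}}}

*-pos : ∀ {p q} → 0ℚ < p → 0ℚ < q → 0ℚ < p * q
*-pos {p} {q} 0<p 0<q = ℚP.positive⁻¹ _ {{ℚP.pos*pos⇒pos p {{ℚ.positive 0<p}} q {{ℚ.positive 0<q}}}}

+-nonNeg : ∀ {p q} → 0ℚ ≤ p → 0ℚ ≤ q → 0ℚ ≤ p + q
+-nonNeg {p} {q} 0≤p 0≤q = subst (_≤ p + q) (ℚP.+-identityʳ 0ℚ) (ℚP.+-mono-≤ 0≤p 0≤q)

+-pos : ∀ {p q} → 0ℚ < p → 0ℚ ≤ q → 0ℚ < p + q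
+-pos {p} {q} 0<p 0≤q = subst (_< p + q) (ℚP.+-identityʳ 0ℚ) (ℚP.+-mono-<-≤ 0<p 0≤q)

NonNegative : Weight n → Set
NonNegative φ = ∀ c b → 0ℚ ≤ φ c b

weightedSum-nonNeg : ∀ {G : Subset n → ℚ} {φ} → (∀ S → 0ℚ ≤ G S) → NonNegative φ → 0ℚ ≤ weightedSum G φ
weightedSum-nonNeg {zero}  G≥0 φ≥0 = G≥0 []
weightedSum-nonNeg {suc n} G≥0 φ≥0 =
  +-nonNeg (*-nonNeg (φ≥0 zero true)  (weightedSum-nonNeg (G≥0 ∘ (true ∷_))  (φ≥0 ∘ suc)))
           (*-nonNeg (φ≥0 zero false) (weightedSum-nonNeg (G≥0 ∘ (false ∷_)) (φ≥0 ∘ suc)))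

𝟙-nonNeg : ∀ b → 0ℚ ≤ 𝟙 b
𝟙-nonNeg true  = 0≤1
𝟙-nonNeg false = ℚP.≤-refl

pin-nonNeg : ∀ k {χ} {φ : Weight n} → (∀ b → 0ℚ ≤ χ b) → NonNegative φ → NonNegative (pin k χ φ)
pin-nonNeg k χ≥0 φ≥0 c b with c ≟ k
... | yes _ = χ≥0 b
... | no _  = φ≥0 c b

pinnedSum-nonNeg : ∀ (M : BasisSystem n) e f {χ₁ χ₂ φ} → (∀ b → 0ℚ ≤ χ₁ b) → (∀ b → 0ℚ ≤ χ₂ b) → NonNegative φ →
                   0ℚ ≤ pinnedSum M e f χ₁ χ₂ φ
pinnedSum-nonNeg M e f χ₁≥0 χ₂≥0 φ≥0 =
  weightedSum-nonNeg (𝟙-nonNeg ∘ M) (pin-nonNeg e χ₁≥0 (pin-nonNeg f χ₂≥0 φ≥0))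

forceIn-nonNeg : ∀ b → 0ℚ ≤ forceIn b
forceIn-nonNeg = 𝟙-nonNeg

forceOut-nonNeg : ∀ b → 0ℚ ≤ forceOut b
forceOut-nonNeg = 𝟙-nonNeg ∘ not

weightOf-nonNeg : ∀ {y : Fin n → ℚ} → (∀ c → 0ℚ ≤ y c) → NonNegative (weightOf y)
weightOf-nonNeg y≥0 c true  = y≥0 c
weightOf-nonNeg y≥0 c false = 0≤1

-- Rayleigh matroids are closed under parallel extension

-- The variable of a collapsed class: the sum of the variables of its copies.
aggregate : (m : Vec ℕ n) → (Fin (Vec.sum m) → ℚ) → Fin n → ℚ
aggregate m y c = classIn (lookup m c) (weightOf y ∘ copy m c)

collapse-weightOf : ∀ (m : Vec ℕ n) y → collapse m (weightOf y) ≐ weightOf (aggregate m y)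
collapse-weightOf m y c true  = refl
collapse-weightOf m y c false = classOut-normalised (lookup m c) (weightOf y ∘ copy m c) (λ _ → refl)

classOut-nonNeg : ∀ a {χ : Weight a} → NonNegative χ → 0ℚ ≤ classOut a χ
classOut-nonNeg zero    χ≥0 = 0≤1
classOut-nonNeg (suc a) χ≥0 = *-nonNeg (χ≥0 zero false) (classOut-nonNeg a (χ≥0 ∘ suc))

classIn-nonNeg : ∀ a {χ : Weight a} → NonNegative χ → 0ℚ ≤ classIn a χ
classIn-nonNeg zero    χ≥0 = ℚP.≤-refl
classIn-nonNeg (suc a) χ≥0 = +-nonNeg (*-nonNeg (χ≥0 zero true)  (classOut-nonNeg a (χ≥0 ∘ suc)))
                                      (*-nonNeg (χ≥0 zero false) (classIn-nonNeg a (χ≥0 ∘ suc)))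

aggregate-pos : ∀ (m : Vec ℕ n) {y} → Positive m → (∀ k → 0ℚ < y k) → ∀ c → 0ℚ < aggregate m y c
aggregate-pos m {y} m>0 y>0 c = classIn-pos (lookup m c) (m>0 c) (y>0 ∘ copy m c)
  where
  classIn-pos : ∀ a → 1 ℕ.≤ a → {z : Fin a → ℚ} → (∀ k → 0ℚ < z k) → 0ℚ < classIn a (weightOf z)
  classIn-pos (suc a) _ {z} z>0 =
    +-pos (*-pos (z>0 zero) (subst (0ℚ <_) (sym (classOut-normalised a (weightOf (z ∘ suc)) (λ _ → refl)))
                                             (ℚP.positive⁻¹ 1ℚ)))
          (*-nonNeg 0≤1 (classIn-nonNeg a (weightOf-nonNeg (λ k → ℚP.<⇒≤ (z>0 (suc k))))))

rayleighForm-cong : ∀ (M : BasisSystem n) e f {φ ψ} → φ ≐ ψ → rayleighForm M e f φ ≡ rayleighForm M e f ψ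
rayleighForm-cong M e f φ≐ψ =
  cong₂ _-_ (cong₂ _*_ (P forceIn forceOut) (P forceOut forceIn)) (cong₂ _*_ (P forceIn forceIn) (P forceOut forceOut))
  where P = λ χ₁ χ₂ → pinnedSum-cong M e f {χ₁} {χ₁} {χ₂} {χ₂} (λ _ → refl) (λ _ → refl) φ≐ψ

copy-≢ : ∀ (m : Vec ℕ n) {e f} j j′ → e ≢ f → copy m e j ≢ copy m f j′
copy-≢ m {e} {f} j j′ e≢f eq = e≢f (trans (sym (parent-copy m e j)) (trans (cong (parent m) eq) (parent-copy m f j′)))

forAllCopies : ∀ (m : Vec ℕ n) (P : Fin (Vec.sum m) → Set) → (∀ c j → P (copy m c j)) → ∀ k → P k
forAllCopies m P P-copies k = subst P (proj₂ (copy-surjective m k)) (P-copies (parent m k) _)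

Δ-parallelExt : ∀ (M : BasisSystem n) m {e f} j j′ y → e ≢ f →
  Δ (parallelExt M m) (copy m e j) (copy m f j′) y ≡ Δ M e f (aggregate m y)
Δ-parallelExt M m {e} {f} j j′ y e≢f = begin
  Δ (parallelExt M m) (copy m e j) (copy m f j′) y
    ≡⟨ Δ≡rayleighForm (parallelExt M m) y (copy-≢ m j j′ e≢f) ⟩
  rayleighForm (parallelExt M m) (copy m e j) (copy m f j′) (weightOf y)
    ≡⟨ rayleighForm-parallelExt M m j j′ e≢f (λ _ → refl) ⟩
  rayleighForm M e f (collapse m (weightOf y))
    ≡⟨ rayleighForm-cong M e f (collapse-weightOf m y) ⟩
  rayleighForm M e f (weightOf (aggregate m y))
    ≡⟨ sym (Δ≡rayleighForm M (aggregate m y) e≢f) ⟩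
  Δ M e f (aggregate m y) ∎
  where open ≡-Reasoning

Δ-parallelExt-sameClass-nonNeg : ∀ (M : BasisSystem n) m c {j j′ : Fin (lookup m c)} y → (∀ k → 0ℚ ≤ y k) → j ≢ j′ →
  0ℚ ≤ Δ (parallelExt M m) (copy m c j) (copy m c j′) y
Δ-parallelExt-sameClass-nonNeg M m c {j} {j′} y y≥0 j≢j′ =
  subst (0ℚ ≤_) (sym Δ≡P₁P₂) (*-nonNeg (P≥0 forceIn-nonNeg forceOut-nonNeg) (P≥0 forceOut-nonNeg forceIn-nonNeg))
  where
  P = λ χ₁ χ₂ → pinnedSum (parallelExt M m) (copy m c j) (copy m c j′) χ₁ χ₂ (weightOf y)
  P≥0 = λ {χ₁ χ₂} χ₁≥0 χ₂≥0 →
    pinnedSum-nonNeg (parallelExt M m) (copy m c j) (copy m c j′) {χ₁} {χ₂} χ₁≥0 χ₂≥0 (weightOf-nonNeg y≥0)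
  Δ≡P₁P₂ : Δ (parallelExt M m) (copy m c j) (copy m c j′) y ≡ P forceIn forceOut * P forceOut forceIn
  Δ≡P₁P₂ = begin
    Δ (parallelExt M m) (copy m c j) (copy m c j′) y
      ≡⟨ Δ≡rayleighForm (parallelExt M m) y (j≢j′ ∘ copy-injective m c) ⟩
    P forceIn forceOut * P forceOut forceIn - P forceIn forceIn * P forceOut forceOut
      ≡⟨ cong (λ x → P forceIn forceOut * P forceOut forceIn - x * P forceOut forceOut)
              (pinnedSum-parallelExt-sameClass M m c (weightOf y) j≢j′) ⟩
    P forceIn forceOut * P forceOut forceIn - 0ℚ * P forceOut forceOut
      ≡⟨ solve 3 (λ a b d → a :* b :- con 0ℚ :* d := a :* b) refl (P forceIn forceOut) (P forceOut forceIn) (P forceOut forceOut) ⟩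
    P forceIn forceOut * P forceOut forceIn ∎
    where open ≡-Reasoning

rayleigh-parallelExt : ∀ (M : BasisSystem n) → Rayleigh M → ∀ m → Positive m → Rayleigh (parallelExt M m)
rayleigh-parallelExt M isRayleigh m m>0 y y>0 =
  forAllCopies m _ λ e j → forAllCopies m _ λ f j′ → atCopies e j f j′
  where
  atCopies : ∀ e j f j′ → copy m e j ≢ copy m f j′ → 0ℚ ≤ Δ (parallelExt M m) (copy m e j) (copy m f j′) y
  atCopies e j f j′ copies≢ with e ≟ f
  ... | yes refl = Δ-parallelExt-sameClass-nonNeg M m e y (ℚP.<⇒≤ ∘ y>0) (copies≢ ∘ cong (copy m e))
  ... | no e≢f   = subst (0ℚ ≤_) (sym (Δ-parallelExt M m j j′ y e≢f))
                         (isRayleigh (aggregate m y) (aggregate-pos m m>0 y>0) e f e≢f)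

-- Rayleigh matroids are closed under taking minors

0≤∣p∣-p : ∀ p → 0ℚ ≤ ℚ.∣ p ∣ - p
0≤∣p∣-p p with ℚP.∣p∣≡p∨∣p∣≡-p p
... | inj₁ ∣p∣≡p  = ℚP.≤-reflexive (sym (trans (cong (_- p) ∣p∣≡p) (ℚP.+-inverseʳ p)))
... | inj₂ ∣p∣≡-p = subst (λ x → 0ℚ ≤ ℚ.∣ p ∣ + x) ∣p∣≡-p (+-nonNeg (ℚP.0≤∣p∣ p) (ℚP.0≤∣p∣ p))

inverse : ∀ p → 0ℚ < p → Σ ℚ λ r → 0ℚ < r × p * r ≡ 1ℚ
inverse p 0<p = (ℚ.1/ p) {{p≢0}} , ℚP.positive⁻¹ _ {{ℚP.1/pos⇒pos p {{ℚ.positive 0<p}}}} , ℚP.*-inverseʳ p {{p≢0}}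
  where p≢0 = ℚP.pos⇒nonZero p {{ℚ.positive 0<p}}

-- If A < 0, put u = -A and t = u / (u + ∣B∣ + ∣C∣); then A + B t + C t² = -P for an explicit P > 0.
quadratic-constant-nonNeg : ∀ A B C → (∀ t → 0ℚ < t → 0ℚ ≤ A + B * t + C * (t * t)) → 0ℚ ≤ A
quadratic-constant-nonNeg A B C nonNeg with 0ℚ ℚP.≤? A
... | yes 0≤A = 0≤A
... | no  0≰A = ⊥-elim (ℚP.<-irrefl refl (subst (0ℚ <_) Q+P≡0 (ℚP.≤-<-trans (nonNeg t 0<t) Q<Q+P)))
  where
  u = ℚ.- A
  β = ℚ.∣ B ∣
  γ = ℚ.∣ C ∣
  0<u : 0ℚ < u
  0<u = ℚP.neg-antimono-< (ℚP.≰⇒> 0≰A)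
  D⁻¹ = inverse (u + β + γ) (+-pos (+-pos 0<u (ℚP.0≤∣p∣ B)) (ℚP.0≤∣p∣ C))
  r = proj₁ D⁻¹
  0<r = proj₁ (proj₂ D⁻¹)
  Dr≡1 : (u + β + γ) * r ≡ 1ℚ
  Dr≡1 = proj₂ (proj₂ D⁻¹)
  t = u * r
  0<t = *-pos 0<u 0<r
  0≤t = ℚP.<⇒≤ 0<t
  Q = A + B * t + C * (t * t)
  P = u * t + (β - B) * t + (γ - C) * (t * t) + γ * t * ((β + γ) * r)
  0<P : 0ℚ < P
  0<P = +-pos (+-pos (+-pos (*-pos 0<u 0<t) (*-nonNeg (0≤∣p∣-p B) 0≤t)) (*-nonNeg (0≤∣p∣-p C) (*-nonNeg 0≤t 0≤t)))
              (*-nonNeg (*-nonNeg (ℚP.0≤∣p∣ C) 0≤t) (*-nonNeg (+-nonNeg (ℚP.0≤∣p∣ B) (ℚP.0≤∣p∣ C)) (ℚP.<⇒≤ 0<r)))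
  Q+P≡0 : Q + P ≡ 0ℚ
  Q+P≡0 = begin
    Q + P
      ≡⟨ solve 7 (λ A B C u b g r →
            (A :+ B :* (u :* r) :+ C :* ((u :* r) :* (u :* r)))
            :+ (u :* (u :* r) :+ (b :- B) :* (u :* r) :+ (g :- C) :* ((u :* r) :* (u :* r)) :+ g :* (u :* r) :* ((b :+ g) :* r))
            := A :+ (u :* u :* r :+ b :* u :* r) :+ g :* (u :* r) :* ((u :+ b :+ g) :* r)) refl A B C u β γ r ⟩
    A + (u * u * r + β * u * r) + γ * t * ((u + β + γ) * r)
      ≡⟨ cong (λ x → A + (u * u * r + β * u * r) + γ * t * x) Dr≡1 ⟩
    A + (u * u * r + β * u * r) + γ * t * 1ℚ
      ≡⟨ solve 5 (λ A u b g r → A :+ (u :* u :* r :+ b :* u :* r) :+ g :* (u :* r) :* con 1ℚ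
                               := A :+ u :* ((u :+ b :+ g) :* r)) refl A u β γ r ⟩
    A + u * ((u + β + γ) * r)
      ≡⟨ cong (λ x → A + u * x) Dr≡1 ⟩
    A + u * 1ℚ
      ≡⟨ trans (cong (A +_) (ℚP.*-identityʳ u)) (ℚP.+-inverseʳ A) ⟩
    0ℚ ∎
    where open ≡-Reasoning
  Q<Q+P : Q < Q + P
  Q<Q+P = subst (_< Q + P) (ℚP.+-identityʳ Q) (ℚP.+-monoʳ-< Q 0<P)

quadratic-leading-nonNeg : ∀ A B C → (∀ t → 0ℚ < t → 0ℚ ≤ A + B * t + C * (t * t)) → 0ℚ ≤ C
quadratic-leading-nonNeg A B C nonNeg = quadratic-constant-nonNeg C B A reversed
  where
  reversed : ∀ s → 0ℚ < s → 0ℚ ≤ C + B * s + A * (s * s)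
  reversed s 0<s = subst (0ℚ ≤_) s²Q[1/s]≡ (*-nonNeg (*-nonNeg 0≤s 0≤s) (nonNeg r 0<r))
    where
    0≤s = ℚP.<⇒≤ 0<s
    s⁻¹ = inverse s 0<s
    r = proj₁ s⁻¹
    0<r = proj₁ (proj₂ s⁻¹)
    sr≡1 : s * r ≡ 1ℚ
    sr≡1 = proj₂ (proj₂ s⁻¹)
    s²Q[1/s]≡ : s * s * (A + B * r + C * (r * r)) ≡ C + B * s + A * (s * s)
    s²Q[1/s]≡ = begin
      s * s * (A + B * r + C * (r * r))
        ≡⟨ solve 5 (λ A B C s r → s :* s :* (A :+ B :* r :+ C :* (r :* r))
                       := A :* (s :* s) :+ B :* s :* (s :* r) :+ C :* ((s :* r) :* (s :* r))) refl A B C s r ⟩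
      A * (s * s) + B * s * (s * r) + C * ((s * r) * (s * r))
        ≡⟨ cong (λ x → A * (s * s) + B * s * x + C * (x * x)) sr≡1 ⟩
      A * (s * s) + B * s * 1ℚ + C * (1ℚ * 1ℚ)
        ≡⟨ solve 4 (λ A B C s → A :* (s :* s) :+ B :* s :* con 1ℚ :+ C :* (con 1ℚ :* con 1ℚ)
                       := C :+ B :* s :+ A :* (s :* s)) refl A B C s ⟩
      C + B * s + A * (s * s) ∎
      where open ≡-Reasoning

restrict : BasisSystem (suc n) → Fin (suc n) → Bool → BasisSystem n
restrict M e b S = M (insertAt S e b)

insertAt-all : ∀ {A : Set} (P : A → Set) {xs : Fin n → A} {v} i →
               (∀ k → P (xs k)) → P v → ∀ c → P (VecF.insertAt xs i v c)
insertAt-all         P zero    Pxs Pv zero    = Pv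
insertAt-all         P zero    Pxs Pv (suc c) = Pxs c
insertAt-all {suc n} P (suc i) Pxs Pv zero    = Pxs zero
insertAt-all {suc n} P (suc i) Pxs Pv (suc c) = insertAt-all P i (Pxs ∘ suc) Pv c

pin-punchIn : ∀ e f χ (φ : Weight (suc n)) → (pin (punchIn e f) χ φ ∘ punchIn e) ≐ pin f χ (φ ∘ punchIn e)
pin-punchIn e f χ φ = ≐-pin f χ (φ ∘ punchIn e) (pin-here (punchIn e f) χ φ refl)
  (λ c c≢f → pin-there (punchIn e f) χ φ (c≢f ∘ punchIn-injective e c f))

pinnedSum-restrict : ∀ (M : BasisSystem (suc n)) e f g χ₁ χ₂ (y : Fin n → ℚ) t →
  pinnedSum M (punchIn e f) (punchIn e g) χ₁ χ₂ (weightOf (VecF.insertAt y e t))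
  ≡ t * pinnedSum (restrict M e true) f g χ₁ χ₂ (weightOf y) + 1ℚ * pinnedSum (restrict M e false) f g χ₁ χ₂ (weightOf y)
pinnedSum-restrict M e f g χ₁ χ₂ y t =
  trans (weightedSum-expand e (𝟙 ∘ M) φ)
        (cong₂ _+_ (cong₂ _*_ (at-e true)  (weightedSum-cong (λ _ → refl) off-e))
                   (cong₂ _*_ (at-e false) (weightedSum-cong (λ _ → refl) off-e)))
  where
  φ = pin (punchIn e f) χ₁ (pin (punchIn e g) χ₂ (weightOf (VecF.insertAt y e t)))
  at-e : ∀ b → φ e b ≡ (if b then t else 1ℚ)
  at-e b = trans (pin-there (punchIn e f) χ₁ _ (punchInᵢ≢i e f ∘ sym) b)
          (trans (pin-there (punchIn e g) χ₂ _ (punchInᵢ≢i e g ∘ sym) b)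
                 (cong (λ x → if b then x else 1ℚ) (VecFₚ.insertAt-lookup y e t)))
  off-e : (φ ∘ punchIn e) ≐ pin f χ₁ (pin g χ₂ (weightOf y))
  off-e c b = trans (pin-punchIn e f χ₁ _ c b)
    (pin-cong f (λ _ → refl) (λ c′ b′ → trans (pin-punchIn e g χ₂ _ c′ b′)
      (pin-cong g (λ _ → refl) (λ k b″ → cong (λ x → if b″ then x else 1ℚ) (VecFₚ.insertAt-punchIn y e t k)) c′ b′)) c b)

rayleigh-restrict : ∀ (M : BasisSystem (suc n)) e → Rayleigh M → ∀ b → Rayleigh (restrict M e b)
rayleigh-restrict M e isRayleigh b y y>0 f g f≢g =
  subst (0ℚ ≤_) (sym (Δ≡rayleighForm (restrict M e b) y f≢g)) (coefficient b)
  where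
  P = λ b′ χ₁ χ₂ → pinnedSum (restrict M e b′) f g χ₁ χ₂ (weightOf y)
  F = λ b′ → rayleighForm (restrict M e b′) f g (weightOf y)
  B₁ = P true forceIn forceOut * P false forceOut forceIn + P false forceIn forceOut * P true forceOut forceIn
     - P true forceIn forceIn * P false forceOut forceOut - P false forceIn forceIn * P true forceOut forceOut
  quadratic : ∀ t → 0ℚ < t → 0ℚ ≤ F false + B₁ * t + F true * (t * t)
  quadratic t 0<t = subst (0ℚ ≤_) Δ≡quadratic
    (isRayleigh (VecF.insertAt y e t) (insertAt-all (0ℚ <_) e y>0 0<t) (punchIn e f) (punchIn e g) (f≢g ∘ punchIn-injective e f g))
    where
    expand = λ χ₁ χ₂ → pinnedSum-restrict M e f g χ₁ χ₂ y t
    Δ≡quadratic : Δ M (punchIn e f) (punchIn e g) (VecF.insertAt y e t) ≡ F false + B₁ * t + F true * (t * t)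
    Δ≡quadratic =
      trans (Δ≡rayleighForm M _ (f≢g ∘ punchIn-injective e f g))
      (trans (cong₂ _-_ (cong₂ _*_ (expand forceIn forceOut) (expand forceOut forceIn))
                        (cong₂ _*_ (expand forceIn forceIn) (expand forceOut forceOut)))
             (solve 9 (λ a₁ b₁ c₁ d₁ a₀ b₀ c₀ d₀ t →
                     (t :* a₁ :+ con 1ℚ :* a₀) :* (t :* b₁ :+ con 1ℚ :* b₀)
                  :- (t :* c₁ :+ con 1ℚ :* c₀) :* (t :* d₁ :+ con 1ℚ :* d₀)
                  := (a₀ :* b₀ :- c₀ :* d₀) :+ (a₁ :* b₀ :+ a₀ :* b₁ :- c₁ :* d₀ :- c₀ :* d₁) :* t
                     :+ (a₁ :* b₁ :- c₁ :* d₁) :* (t :* t))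
                refl (P true forceIn forceOut) (P true forceOut forceIn) (P true forceIn forceIn) (P true forceOut forceOut)
                     (P false forceIn forceOut) (P false forceOut forceIn) (P false forceIn forceIn) (P false forceOut forceOut) t))
  coefficient : ∀ b′ → 0ℚ ≤ F b′
  coefficient true  = quadratic-leading-nonNeg (F false) B₁ (F true) quadratic
  coefficient false = quadratic-constant-nonNeg (F false) B₁ (F true) quadratic

Δ-cong : ∀ {M M′ : BasisSystem n} → (∀ S → M S ≡ M′ S) → ∀ e f y → Δ M e f y ≡ Δ M′ e f y
Δ-cong {n} {M} {M′} M≗M′ e f y =
  cong₂ _-_ (cong₂ _*_ (genPoly-cong ⁅ e ⁆ ⁅ f ⁆) (genPoly-cong ⁅ f ⁆ ⁅ e ⁆))
            (cong₂ _*_ (genPoly-cong (⁅ e ⁆ ∪ ⁅ f ⁆) ∅ₛ) (genPoly-cong ∅ₛ (⁅ e ⁆ ∪ ⁅ f ⁆)))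
  where
  genPoly-cong : ∀ I J → genPoly M I J y ≡ genPoly M′ I J y
  genPoly-cong I J = cong sumℚ (Listₚ.map-cong
    (λ B → cong (λ b → if b ∧ admissible I J B then prodOver (λ c → c ∈ᵇ B ∧ not (c ∈ᵇ I)) y else 0ℚ) (M≗M′ B))
    (allSubsets n))

rayleigh-cong : ∀ {M M′ : BasisSystem n} → (∀ S → M S ≡ M′ S) → Rayleigh M → Rayleigh M′
rayleigh-cong M≗M′ isRayleigh y y>0 e f e≢f = subst (0ℚ ≤_) (Δ-cong M≗M′ e f y) (isRayleigh y y>0 e f e≢f)

delete≗restrict : ∀ (M : BasisSystem (suc n)) e S → restrict M e (isColoop M e) S ≡ delete M e S
delete≗restrict M e S with isColoop M e
... | true  = refl
... | false = refl

contract≗restrict : ∀ (M : BasisSystem (suc n)) e S → restrict M e (not (isLoop M e)) S ≡ contract M e S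
contract≗restrict M e S with isLoop M e
... | true  = refl
... | false = refl

rayleigh-minor : ∀ {k n} {N : BasisSystem k} {M : BasisSystem n} → Minor N M → Rayleigh M → Rayleigh N
rayleigh-minor self        isRayleigh = isRayleigh
rayleigh-minor {M = M} (del e N≤M) isRayleigh =
  rayleigh-minor N≤M (rayleigh-cong (delete≗restrict M e) (rayleigh-restrict M e isRayleigh (isColoop M e)))
rayleigh-minor {M = M} (con e N≤M) isRayleigh =
  rayleigh-minor N≤M (rayleigh-cong (contract≗restrict M e) (rayleigh-restrict M e isRayleigh (not (isLoop M e))))

rayleigh⇒negCorrelated : ∀ {M : BasisSystem n} → Rayleigh M → NegCorrelated M
rayleigh⇒negCorrelated isRayleigh = isRayleigh (λ _ → 1ℚ) (λ _ → ℚP.positive⁻¹ 1ℚ)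

rayleigh⇒balanced : ∀ {M : BasisSystem n} → Rayleigh M → Balanced M
rayleigh⇒balanced isRayleigh k N N≤M = rayleigh⇒negCorrelated (rayleigh-minor N≤M isRayleigh)

-- Bases of a matroid have the same size

bit : Bool → ℕ
bit b = if b then 1 else 0

∣∣-agreeOff : ∀ (p q : Subset n) i → (∀ c → c ≢ i → lookup p c ≡ lookup q c) →
              ∣ p ∣ ℕ.+ bit (lookup q i) ≡ ∣ q ∣ ℕ.+ bit (lookup p i)
∣∣-agreeOff (a ∷ p) (b ∷ q) zero agree =
  subst (λ p′ → ∣ a ∷ p′ ∣ ℕ.+ bit b ≡ ∣ b ∷ q ∣ ℕ.+ bit a) (sym tails≡) (heads a b)
  where
  tails≡ : p ≡ q
  tails≡ = trans (sym (Vecₚ.tabulate∘lookup p))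
                 (trans (Vecₚ.tabulate-cong (λ c → agree (suc c) λ ())) (Vecₚ.tabulate∘lookup q))
  heads : ∀ a b → ∣ a ∷ q ∣ ℕ.+ bit b ≡ ∣ b ∷ q ∣ ℕ.+ bit a
  heads true  true  = refl
  heads false false = refl
  heads true  false = trans (ℕP.+-identityʳ _) (ℕP.+-comm 1 ∣ q ∣)
  heads false true  = sym (trans (ℕP.+-identityʳ _) (ℕP.+-comm 1 ∣ q ∣))
∣∣-agreeOff (a ∷ p) (b ∷ q) (suc i) agree rewrite agree zero (λ ()) with b
... | true  = cong suc (∣∣-agreeOff p q i (λ c c≢i → agree (suc c) (c≢i ∘ suc-injective)))
... | false = ∣∣-agreeOff p q i (λ c c≢i → agree (suc c) (c≢i ∘ suc-injective))

∣∣-insert : ∀ (p q : Subset n) i → lookup p i ≡ false → lookup q i ≡ true →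
            (∀ c → c ≢ i → lookup p c ≡ lookup q c) → suc ∣ p ∣ ≡ ∣ q ∣
∣∣-insert p q i i∉p i∈q agree with ∣∣-agreeOff p q i agree
... | eq rewrite i∉p | i∈q = trans (ℕP.+-comm 1 ∣ p ∣) (trans eq (ℕP.+-identityʳ ∣ q ∣))

∣∣-agree : ∀ (p q : Subset n) i → lookup p i ≡ lookup q i → (∀ c → c ≢ i → lookup p c ≡ lookup q c) →
           ∣ p ∣ ≡ ∣ q ∣
∣∣-agree p q i pᵢ≡qᵢ agree =
  ℕP.+-cancelʳ-≡ (bit (lookup p i)) ∣ p ∣ ∣ q ∣
    (trans (cong (λ b → ∣ p ∣ ℕ.+ bit b) pᵢ≡qᵢ) (∣∣-agreeOff p q i agree))

lookup-─ : ∀ (p q : Subset n) c → lookup (p ─ q) c ≡ (if lookup q c then false else lookup p c)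
lookup-─ p q c = lookup-zipWith (λ _ → refl) (λ _ → refl)
  where
  lookup-zipWith : ∀ {f : Bool → Bool → Bool} → (∀ a → f a true ≡ false) → (∀ a → f a false ≡ a) →
                   lookup (Vec.zipWith f p q) c ≡ (if lookup q c then false else lookup p c)
  lookup-zipWith {f} f₁ f₀ with lookup q c in q꜀
  ... | true  = trans (Vecₚ.lookup-zipWith f c p q) (trans (cong (f (lookup p c)) q꜀) (f₁ (lookup p c)))
  ... | false = trans (Vecₚ.lookup-zipWith f c p q) (trans (cong (f (lookup p c)) q꜀) (f₀ (lookup p c)))

lookup-∩∁ : ∀ (p q : Subset n) c → lookup (p ∩ ∁ q) c ≡ lookup p c ∧ not (lookup q c)
lookup-∩∁ p q c = trans (Vecₚ.lookup-zipWith _∧_ c p (∁ q)) (cong (lookup p c ∧_) (Vecₚ.lookup-map c not q))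

lookup-∩∁-∈ : ∀ (p q : Subset n) c → lookup q c ≡ true → lookup (p ∩ ∁ q) c ≡ false
lookup-∩∁-∈ p q c c∈q rewrite lookup-∩∁ p q c | c∈q = ∧-zeroʳ (lookup p c)

lookup-∩∁-∉ : ∀ (p q : Subset n) c → lookup q c ≡ false → lookup (p ∩ ∁ q) c ≡ lookup p c
lookup-∩∁-∉ p q c c∉q rewrite lookup-∩∁ p q c | c∉q = ∧-identityʳ (lookup p c)

∩∁-agreeOff : ∀ {p q : Subset n} r {i} → (∀ c → c ≢ i → lookup p c ≡ lookup q c) →
              ∀ c → c ≢ i → lookup (p ∩ ∁ r) c ≡ lookup (q ∩ ∁ r) c
∩∁-agreeOff {p = p} {q} r agree c c≢i
  rewrite lookup-∩∁ p r c | lookup-∩∁ q r c | agree c c≢i = refl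

∣∩∁∣≡0⇒∣∣≤∣∣ : ∀ (p q : Subset n) → ∣ p ∩ ∁ q ∣ ≡ 0 → ∣ p ∣ ℕ.≤ ∣ q ∣
∣∩∁∣≡0⇒∣∣≤∣∣ []          []          _  = ℕ.z≤n
∣∩∁∣≡0⇒∣∣≤∣∣ (true  ∷ p) (true  ∷ q) eq = ℕ.s≤s (∣∩∁∣≡0⇒∣∣≤∣∣ p q eq)
∣∩∁∣≡0⇒∣∣≤∣∣ (false ∷ p) (true  ∷ q) eq = ℕP.m≤n⇒m≤1+n (∣∩∁∣≡0⇒∣∣≤∣∣ p q eq)
∣∩∁∣≡0⇒∣∣≤∣∣ (false ∷ p) (false ∷ q) eq = ∣∩∁∣≡0⇒∣∣≤∣∣ p q eq

∣∩∁∣≡suc⇒∃ : ∀ (p q : Subset n) {k} → ∣ p ∩ ∁ q ∣ ≡ suc k →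
             Σ (Fin n) λ x → (x ∈ᵇ p ≡ true) × (x ∈ᵇ q ≡ false)
∣∩∁∣≡suc⇒∃ []          []          ()
∣∩∁∣≡suc⇒∃ (true  ∷ p) (false ∷ q) eq = zero , refl , refl
∣∩∁∣≡suc⇒∃ (true  ∷ p) (true  ∷ q) eq = let x , x∈p , x∉q = ∣∩∁∣≡suc⇒∃ p q eq in suc x , x∈p , x∉q
∣∩∁∣≡suc⇒∃ (false ∷ p) (b     ∷ q) eq = let x , x∈p , x∉q = ∣∩∁∣≡suc⇒∃ p q eq in suc x , x∈p , x∉q

module _ (B₁ B₂ : Subset n) {x y} (x∈B₁ : x ∈ᵇ B₁ ≡ true) (x∉B₂ : x ∈ᵇ B₂ ≡ false)
         (y∈B₂ : y ∈ᵇ B₂ ≡ true) (y∉B₁ : y ∈ᵇ B₁ ≡ false) where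

  private
    B₁ᵐ = B₁ ─ ⁅ x ⁆
    B₁′ = B₁ᵐ +ₛ y
    y≢x : y ≢ x
    y≢x y≡x with trans (sym y∉B₁) (trans (cong (lookup B₁) y≡x) x∈B₁)
    ... | ()
    B₁ᵐ-agree : ∀ c → c ≢ x → lookup B₁ᵐ c ≡ lookup B₁ c
    B₁ᵐ-agree c c≢x = trans (lookup-─ B₁ ⁅ x ⁆ c) (cong (λ b → if b then false else lookup B₁ c) (lookup-⁅y⁆ c≢x))
    x∉B₁ᵐ : lookup B₁ᵐ x ≡ false
    x∉B₁ᵐ = trans (lookup-─ B₁ ⁅ x ⁆ x) (cong (λ b → if b then false else lookup B₁ x) (lookup-⁅x⁆ x))
    y∉B₁ᵐ : lookup B₁ᵐ y ≡ false
    y∉B₁ᵐ = trans (B₁ᵐ-agree y y≢x) y∉B₁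
    y∈B₁′ : lookup B₁′ y ≡ true
    y∈B₁′ = Vecₚ.lookup∘updateAt y B₁ᵐ
    B₁′-agree : ∀ c → c ≢ y → lookup B₁ᵐ c ≡ lookup B₁′ c
    B₁′-agree c c≢y = sym (Vecₚ.lookup∘updateAt′ c y c≢y B₁ᵐ)

  exchange-∣∣ : ∣ (B₁ ─ ⁅ x ⁆) +ₛ y ∣ ≡ ∣ B₁ ∣
  exchange-∣∣ = trans (sym (∣∣-insert B₁ᵐ B₁′ y y∉B₁ᵐ y∈B₁′ B₁′-agree)) (∣∣-insert B₁ᵐ B₁ x x∉B₁ᵐ x∈B₁ B₁ᵐ-agree)

  exchange-∣∩∁∣ : suc ∣ ((B₁ ─ ⁅ x ⁆) +ₛ y) ∩ ∁ B₂ ∣ ≡ ∣ B₁ ∩ ∁ B₂ ∣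
  exchange-∣∩∁∣ = begin
    suc ∣ B₁′ ∩ ∁ B₂ ∣
      ≡⟨ cong suc (sym (∣∣-agree (B₁ᵐ ∩ ∁ B₂) (B₁′ ∩ ∁ B₂) y
                         (trans (lookup-∩∁-∈ B₁ᵐ B₂ y y∈B₂) (sym (lookup-∩∁-∈ B₁′ B₂ y y∈B₂)))
                         (∩∁-agreeOff {p = B₁ᵐ} {B₁′} B₂ B₁′-agree))) ⟩
    suc ∣ B₁ᵐ ∩ ∁ B₂ ∣
      ≡⟨ ∣∣-insert (B₁ᵐ ∩ ∁ B₂) (B₁ ∩ ∁ B₂) x (trans (lookup-∩∁-∉ B₁ᵐ B₂ x x∉B₂) x∉B₁ᵐ)
                   (trans (lookup-∩∁-∉ B₁ B₂ x x∉B₂) x∈B₁) (∩∁-agreeOff {p = B₁ᵐ} {B₁} B₂ B₁ᵐ-agree) ⟩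
    ∣ B₁ ∩ ∁ B₂ ∣ ∎
    where open ≡-Reasoning

module _ {M : BasisSystem n} (isMatroid : IsMatroid M) where

  basis-∣∣-≤ : ∀ k B₁ B₂ → ∣ B₁ ∩ ∁ B₂ ∣ ≡ k → IsBasis M B₁ → IsBasis M B₂ → ∣ B₁ ∣ ℕ.≤ ∣ B₂ ∣
  basis-∣∣-≤ zero    B₁ B₂ d≡0 _ _ = ∣∩∁∣≡0⇒∣∣≤∣∣ B₁ B₂ d≡0
  basis-∣∣-≤ (suc k) B₁ B₂ d≡1+k b₁ b₂ with ∣∩∁∣≡suc⇒∃ B₁ B₂ d≡1+k
  ... | x , x∈B₁ , x∉B₂ with IsMatroid.basis-exchange isMatroid B₁ B₂ b₁ b₂ x x∈B₁ x∉B₂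
  ... | y , y∈B₂ , y∉B₁ , b₁′ =
    subst (ℕ._≤ ∣ B₂ ∣) (exchange-∣∣ B₁ B₂ x∈B₁ x∉B₂ y∈B₂ y∉B₁)
      (basis-∣∣-≤ k _ B₂ (ℕP.suc-injective (trans (exchange-∣∩∁∣ B₁ B₂ x∈B₁ x∉B₂ y∈B₂ y∉B₁) d≡1+k)) b₁′ b₂)

  basis-∣∣-≡ : ∀ {B₁ B₂} → IsBasis M B₁ → IsBasis M B₂ → ∣ B₁ ∣ ≡ ∣ B₂ ∣
  basis-∣∣-≡ {B₁} {B₂} b₁ b₂ = ℕP.≤-antisym (basis-∣∣-≤ _ B₁ B₂ refl b₁ b₂) (basis-∣∣-≤ _ B₂ B₁ refl b₂ b₁)

-- Homogeneity of the basis generating polynomial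

_^_ : ℚ → ℕ → ℚ
s ^ zero  = 1ℚ
s ^ suc r = s * s ^ r

scaleIn : ℚ → (Bool → ℚ) → Bool → ℚ
scaleIn s χ b = if b then s * χ true else χ false

scale : ℚ → Weight n → Weight n
scale s φ c = scaleIn s (φ c)

weightedSum-scale : ∀ r {G : Subset n → ℚ} φ s → (∀ S → ∣ S ∣ ≢ r → G S ≡ 0ℚ) →
                    weightedSum G (scale s φ) ≡ s ^ r * weightedSum G φ
weightedSum-scale {zero}  zero    φ s G₀ = sym (ℚP.*-identityˡ _)
weightedSum-scale {zero}  (suc r) φ s G₀ rewrite G₀ [] (λ ()) = sym (ℚP.*-zeroʳ (s ^ suc r))
weightedSum-scale {suc n} zero {G} φ s G₀
  rewrite weightedSum-zero {G = λ S → G (true ∷ S)} (scale s φ ∘ suc) (λ S → G₀ (true ∷ S) (λ ()))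
        | weightedSum-zero {G = λ S → G (true ∷ S)} (φ ∘ suc) (λ S → G₀ (true ∷ S) (λ ()))
        | weightedSum-scale zero (φ ∘ suc) s (λ S → G₀ (false ∷ S)) =
  solve 4 (λ s a b x → s :* a :* con 0ℚ :+ b :* (con 1ℚ :* x) := con 1ℚ :* (a :* con 0ℚ :+ b :* x)) refl
    s (φ zero true) (φ zero false) (weightedSum (λ S → G (false ∷ S)) (φ ∘ suc))
weightedSum-scale {suc n} (suc r) {G} φ s G₀
  rewrite weightedSum-scale r (φ ∘ suc) s (λ S ∣S∣≢r → G₀ (true ∷ S) (∣S∣≢r ∘ ℕP.suc-injective))
        | weightedSum-scale (suc r) (φ ∘ suc) s (λ S → G₀ (false ∷ S)) =
  solve 6 (λ s a b p x y → s :* a :* (p :* x) :+ b :* ((s :* p) :* y) := (s :* p) :* (a :* x :+ b :* y)) refl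
    s (φ zero true) (φ zero false) (s ^ r)
    (weightedSum (λ S → G (true ∷ S)) (φ ∘ suc)) (weightedSum (λ S → G (false ∷ S)) (φ ∘ suc))

rank : ∀ {M : BasisSystem n} → IsMatroid M → ℕ
rank isMatroid = ∣ proj₁ (IsMatroid.basis-nonempty isMatroid) ∣

basisSum-scale : ∀ {M : BasisSystem n} (isMatroid : IsMatroid M) φ s → basisSum M (scale s φ) ≡ s ^ rank isMatroid * basisSum M φ
basisSum-scale {M = M} isMatroid φ s = weightedSum-scale (rank isMatroid) φ s nonBasis
  where
  nonBasis : ∀ S → ∣ S ∣ ≢ rank isMatroid → 𝟙 (M S) ≡ 0ℚ
  nonBasis S ∣S∣≢r with M S in isBasis
  ... | true  = ⊥-elim (∣S∣≢r (basis-∣∣-≡ isMatroid isBasis (proj₂ (IsMatroid.basis-nonempty isMatroid))))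
  ... | false = refl

scale-pin : ∀ s k χ (φ : Weight n) → scale s (pin k χ φ) ≐ pin k (scaleIn s χ) (scale s φ)
scale-pin s k χ φ = ≐-pin k _ (scale s φ)
  (λ { true → cong (s *_) (pin-here k χ φ refl true) ; false → pin-here k χ φ refl false })
  (λ c c≢k → λ { true → cong (s *_) (pin-there k χ φ c≢k true) ; false → pin-there k χ φ c≢k false })

pinnedSum-scale : ∀ {M : BasisSystem n} (isMatroid : IsMatroid M) e f χ₁ χ₂ y s →
  s ^ rank isMatroid * pinnedSum M e f χ₁ χ₂ (weightOf y)
  ≡ pinnedSum M e f (scaleIn s χ₁) (scaleIn s χ₂) (weightOf (λ c → s * y c))
pinnedSum-scale isMatroid e f χ₁ χ₂ y s = trans (sym (basisSum-scale isMatroid _ s))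
  (weightedSum-cong (λ _ → refl) λ c b → trans (scale-pin s e χ₁ _ c b)
    (pin-cong e (λ _ → refl) (λ c′ b′ → trans (scale-pin s f χ₂ _ c′ b′)
      (pin-cong f (λ _ → refl) (λ { _ true → refl ; _ false → refl }) c′ b′)) c b))

Δ-homogeneous : ∀ {M : BasisSystem n} (isMatroid : IsMatroid M) {e f} y s → e ≢ f →
  s ^ rank isMatroid * s ^ rank isMatroid * Δ M e f y ≡ s * s * Δ M e f (λ c → s * y c)
Δ-homogeneous {M = M} isMatroid {e} {f} y s e≢f = begin
  P * P * Δ M e f y
    ≡⟨ cong (P * P *_) (Δ≡rayleighForm M y e≢f) ⟩
  P * P * (Q forceIn forceOut * Q forceOut forceIn - Q forceIn forceIn * Q forceOut forceOut)
    ≡⟨ solve 5 (λ P a b c d → P :* P :* (a :* b :- c :* d) := (P :* a) :* (P :* b) :- (P :* c) :* (P :* d)) refl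
               P (Q forceIn forceOut) (Q forceOut forceIn) (Q forceIn forceIn) (Q forceOut forceOut) ⟩
  P * Q forceIn forceOut * (P * Q forceOut forceIn) - P * Q forceIn forceIn * (P * Q forceOut forceOut)
    ≡⟨ cong₂ _-_ (cong₂ _*_ (scaled forceIn forceOut) (scaled forceOut forceIn))
                 (cong₂ _*_ (scaled forceIn forceIn) (scaled forceOut forceOut)) ⟩
  Qₛ (scaleIn s forceIn) (scaleIn s forceOut) * Qₛ (scaleIn s forceOut) (scaleIn s forceIn)
  - Qₛ (scaleIn s forceIn) (scaleIn s forceIn) * Qₛ (scaleIn s forceOut) (scaleIn s forceOut)
    ≡⟨ cong₂ _-_ (cong₂ _*_ (pinnedSum-bilinear M _ _ _ e≢f) (pinnedSum-bilinear M _ _ _ e≢f))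
                 (cong₂ _*_ (pinnedSum-bilinear M _ _ _ e≢f) (pinnedSum-bilinear M _ _ _ e≢f)) ⟩
  _ ≡⟨ solve 5 (λ s ii io oi oo →
         let P = λ t₁ f₁ t₂ f₂ → t₁ :* (t₂ :* ii :+ f₂ :* io) :+ f₁ :* (t₂ :* oi :+ f₂ :* oo) in
         P (s :* con 1ℚ) (con 0ℚ) (s :* con 0ℚ) (con 1ℚ) :* P (s :* con 0ℚ) (con 1ℚ) (s :* con 1ℚ) (con 0ℚ)
         :- P (s :* con 1ℚ) (con 0ℚ) (s :* con 1ℚ) (con 0ℚ) :* P (s :* con 0ℚ) (con 1ℚ) (s :* con 0ℚ) (con 1ℚ)
         := s :* s :* (io :* oi :- ii :* oo)) refl
       s (Qₛ forceIn forceIn) (Qₛ forceIn forceOut) (Qₛ forceOut forceIn) (Qₛ forceOut forceOut) ⟩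
  s * s * (Qₛ forceIn forceOut * Qₛ forceOut forceIn - Qₛ forceIn forceIn * Qₛ forceOut forceOut)
    ≡⟨ cong (s * s *_) (sym (Δ≡rayleighForm M (λ c → s * y c) e≢f)) ⟩
  s * s * Δ M e f (λ c → s * y c) ∎
  where
  open ≡-Reasoning
  P = s ^ rank isMatroid
  Q = λ χ₁ χ₂ → pinnedSum M e f χ₁ χ₂ (weightOf y)
  Qₛ = λ χ₁ χ₂ → pinnedSum M e f χ₁ χ₂ (weightOf (λ c → s * y c))
  scaled = λ χ₁ χ₂ → pinnedSum-scale isMatroid e f χ₁ χ₂ y s

ι : ℕ → ℚ
ι zero    = 0ℚ
ι (suc k) = 1ℚ + ι k

ι-+ : ∀ a b → ι (a ℕ.+ b) ≡ ι a + ι b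
ι-+ zero    b = sym (ℚP.+-identityˡ (ι b))
ι-+ (suc a) b rewrite ι-+ a b = sym (ℚP.+-assoc 1ℚ (ι a) (ι b))

ι-* : ∀ a b → ι (a ℕ.* b) ≡ ι a * ι b
ι-* zero    b = sym (ℚP.*-zeroˡ (ι b))
ι-* (suc a) b rewrite ι-+ b (a ℕ.* b) | ι-* a b = solve 2 (λ x y → y :+ x :* y := (con 1ℚ :+ x) :* y) refl (ι a) (ι b)

ι-pos : ∀ k → 0ℚ < ι (suc k)
ι-pos k = +-pos (ℚP.positive⁻¹ 1ℚ) (ι-nonNeg k)
  where
  ι-nonNeg : ∀ k → 0ℚ ≤ ι k
  ι-nonNeg zero    = ℚP.≤-refl
  ι-nonNeg (suc k) = +-nonNeg 0≤1 (ι-nonNeg k)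

toℚᵘ-ι : ∀ k → toℚᵘ (ι k) ℚᵘ.≃ ℚᵘ.mkℚᵘ (ℤ.+ k) 0
toℚᵘ-ι zero    = ℚᵘP.≃-refl
toℚᵘ-ι (suc k) =
  ℚᵘP.≃-trans (ℚP.toℚᵘ-homo-+ 1ℚ (ι k))
  (ℚᵘP.≃-trans (ℚᵘP.+-cong {toℚᵘ 1ℚ} {toℚᵘ 1ℚ} ℚᵘP.≃-refl (toℚᵘ-ι k))
               (ℚᵘ.*≡* (trans (Z.solve 1 (λ K → (one Z.:* one Z.:+ K Z.:* one) Z.:* one Z.:= (one Z.:+ K) Z.:* (one Z.:* one))
                                         refl (ℤ.+ k))
                              (cong (ℤ._* (ℤ.+ 1 ℤ.* ℤ.+ 1)) (sym (ℤP.pos-+ 1 k))))))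
  where one = Z.con (ℤ.+ 1)

ι-denominator : ∀ {a d} .(coprime : Coprime a (suc d)) → ι (suc d) * mkℚ (ℤ.+ a) d coprime ≡ ι a
ι-denominator {a} {d} coprime = ℚP.toℚᵘ-injective
  (ℚᵘP.≃-trans (ℚP.toℚᵘ-homo-* (ι (suc d)) q)
  (ℚᵘP.≃-trans (ℚᵘP.*-cong (toℚᵘ-ι (suc d)) (ℚᵘP.≃-refl {toℚᵘ q}))
  (ℚᵘP.≃-trans (ℚᵘ.*≡* cross) (ℚᵘP.≃-sym (toℚᵘ-ι a)))))
  where
  q = mkℚ (ℤ.+ a) d coprime
  cross : (ℤ.+ suc d ℤ.* ℤ.+ a) ℤ.* ℤ.+ 1 ≡ ℤ.+ a ℤ.* ℤ.+ suc (d ℕ.+ 0)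
  cross rewrite ℕP.+-identityʳ d = Z.solve 2 (λ x y → (x Z.:* y) Z.:* Z.con (ℤ.+ 1) Z.:= y Z.:* x) refl (ℤ.+ suc d) (ℤ.+ a)

denominator : ∀ q → 0ℚ < q → Σ ℕ λ a → Σ ℕ λ d → ι (suc d) * q ≡ ι (suc a)
denominator (mkℚ (ℤ.+ suc a) d coprime) _ = a , d , ι-denominator coprime
denominator (mkℚ (ℤ.+ zero)  d _) 0<q with ℚ.positive 0<q
... | ()
denominator (mkℚ ℤ.-[1+ _ ]  d _) 0<q with ℚ.positive 0<q
... | ()

commonDenominator : ∀ (y : Fin n → ℚ) → (∀ c → 0ℚ < y c) →
  Σ ℕ λ N → Σ (Vec ℕ n) λ m → Positive m × (∀ c → ι (lookup m c) ≡ ι (suc N) * y c)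
commonDenominator {zero}  y y>0 = 0 , [] , (λ ()) , (λ ())
commonDenominator {suc n} y y>0 with denominator (y zero) (y>0 zero) | commonDenominator (y ∘ suc) (y>0 ∘ suc)
... | a , d , dy₀≡a | N , m , m>0 , m≡Ny =
  N ℕ.+ d ℕ.* suc N , suc a ℕ.* suc N ∷ Vec.map (suc d ℕ.*_) m , positive , scaled
  where
  open ≡-Reasoning
  positive : Positive (suc a ℕ.* suc N ∷ Vec.map (suc d ℕ.*_) m)
  positive zero    = ℕ.s≤s ℕ.z≤n
  positive (suc c) =
    subst (1 ℕ.≤_) (sym (Vecₚ.lookup-map c (suc d ℕ.*_) m)) (ℕP.*-mono-≤ {1} {suc d} (ℕ.s≤s ℕ.z≤n) (m>0 c))
  scaled : ∀ c → ι (lookup (suc a ℕ.* suc N ∷ Vec.map (suc d ℕ.*_) m) c) ≡ ι (suc d ℕ.* suc N) * y c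
  scaled zero = begin
    ι (suc a ℕ.* suc N)          ≡⟨ ι-* (suc a) (suc N) ⟩
    ι (suc a) * ι (suc N)        ≡⟨ cong (_* ι (suc N)) (sym dy₀≡a) ⟩
    ι (suc d) * y zero * ι (suc N) ≡⟨ solve 3 (λ D y N → D :* y :* N := D :* N :* y) refl (ι (suc d)) (y zero) (ι (suc N)) ⟩
    ι (suc d) * ι (suc N) * y zero ≡⟨ cong (_* y zero) (sym (ι-* (suc d) (suc N))) ⟩
    ι (suc d ℕ.* suc N) * y zero ∎
  scaled (suc c) = begin
    ι (lookup (Vec.map (suc d ℕ.*_) m) c) ≡⟨ cong ι (Vecₚ.lookup-map c (suc d ℕ.*_) m) ⟩
    ι (suc d ℕ.* lookup m c)              ≡⟨ ι-* (suc d) (lookup m c) ⟩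
    ι (suc d) * ι (lookup m c)            ≡⟨ cong (ι (suc d) *_) (m≡Ny c) ⟩
    ι (suc d) * (ι (suc N) * y (suc c))   ≡⟨ sym (ℚP.*-assoc (ι (suc d)) (ι (suc N)) (y (suc c))) ⟩
    ι (suc d) * ι (suc N) * y (suc c)     ≡⟨ cong (_* y (suc c)) (sym (ι-* (suc d) (suc N))) ⟩
    ι (suc d ℕ.* suc N) * y (suc c) ∎

-- Negative correlation of all parallel extensions implies the Rayleigh property

classIn-ones : ∀ a → classIn a (weightOf (λ _ → 1ℚ)) ≡ ι a
classIn-ones zero    = refl
classIn-ones (suc a) = cong₂ _+_ (trans (ℚP.*-identityˡ _) (classOut-normalised a (weightOf (λ _ → 1ℚ)) (λ _ → refl)))
                                 (trans (ℚP.*-identityˡ _) (classIn-ones a))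

^-pos : ∀ {s} r → 0ℚ < s → 0ℚ < s ^ r
^-pos zero    0<s = ℚP.positive⁻¹ 1ℚ
^-pos (suc r) 0<s = *-pos 0<s (^-pos r 0<s)

Δ-cong-variables : ∀ (M : BasisSystem n) {e f} {y y′ : Fin n → ℚ} → (∀ c → y c ≡ y′ c) → e ≢ f →
                   Δ M e f y ≡ Δ M e f y′
Δ-cong-variables M {e} {f} {y} {y′} y≗y′ e≢f =
  trans (Δ≡rayleighForm M y e≢f)
        (trans (rayleighForm-cong M e f (λ { c true → y≗y′ c ; c false → refl }))
               (sym (Δ≡rayleighForm M y′ e≢f)))

negCorrelated⇒rayleigh : ∀ (M : BasisSystem n) → IsMatroid M →
                         (∀ m → Positive m → NegCorrelated (parallelExt M m)) → Rayleigh M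
negCorrelated⇒rayleigh M isMatroid negCorrelated y y>0 e f e≢f =
  ℚP.*-cancelˡ-≤-pos (P * P) {{ℚ.positive (*-pos (^-pos r 0<s) (^-pos r 0<s))}}
    (subst₂ _≤_ (sym (ℚP.*-zeroʳ (P * P))) (sym (Δ-homogeneous isMatroid y s e≢f))
            (*-nonNeg (*-nonNeg (ℚP.<⇒≤ 0<s) (ℚP.<⇒≤ 0<s)) Δ[sy]≥0))
  where
  denominators = commonDenominator y y>0
  N = proj₁ denominators
  m = proj₁ (proj₂ denominators)
  m>0 = proj₁ (proj₂ (proj₂ denominators))
  m≡Ny = proj₂ (proj₂ (proj₂ denominators))
  s = ι (suc N)
  0<s = ι-pos N
  r = rank isMatroid
  P = s ^ r
  j₀ = fromℕ< (m>0 e)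
  j₁ = fromℕ< (m>0 f)
  Δ[sy]≥0 : 0ℚ ≤ Δ M e f (λ c → s * y c)
  Δ[sy]≥0 = subst (0ℚ ≤_)
    (trans (Δ-parallelExt M m j₀ j₁ (λ _ → 1ℚ) e≢f)
           (Δ-cong-variables M (λ c → trans (classIn-ones (lookup m c)) (m≡Ny c)) e≢f))
    (negCorrelated m m>0 (copy m e j₀) (copy m f j₁) (copy-≢ m j₀ j₁ e≢f))

theorem3p6 : (n : ℕ) (M : BasisSystem n) → IsMatroid M →
    (Rayleigh M ⇔ ((m : Vec ℕ n) → Positive m → Rayleigh (parallelExt M m)))
    × (Rayleigh M ⇔ ((m : Vec ℕ n) → Positive m → Balanced (parallelExt M m)))
    × (Rayleigh M ⇔ ((m : Vec ℕ n) → Positive m → NegCorrelated (parallelExt M m)))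
theorem3p6 n M isMatroid =
  mk⇔ (λ isRayleigh m m>0 → rayleigh-parallelExt M isRayleigh m m>0)
      (λ extensionsRayleigh → fromNegCorrelated (λ m m>0 → rayleigh⇒negCorrelated (extensionsRayleigh m m>0))) ,
  mk⇔ (λ isRayleigh m m>0 → rayleigh⇒balanced (rayleigh-parallelExt M isRayleigh m m>0))
      (λ extensionsBalanced → fromNegCorrelated (λ m m>0 → extensionsBalanced m m>0 _ _ self)) ,
  mk⇔ (λ isRayleigh m m>0 → rayleigh⇒negCorrelated (rayleigh-parallelExt M isRayleigh m m>0))
      fromNegCorrelated
  where fromNegCorrelated = negCorrelated⇒rayleigh M isMatroid
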